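{- Let $\kappa \in \mathbb{N}$. (a) Let $H$ be a $\kappa$-connected path-complete graph. Then $\rho(H+e) < \rho(H)$ for every edge $e$ of the complement $\overline{H}$ (i.e. for every pair of non-adjacent vertices of $H$). (b) Let $H, H'$ be two distinct $\kappa$-connected path-complete graphs of order $n$. Then either $m(H) < m(H')$ and $\rho(H) > \rho(H')$, or $m(H) > m(H')$ and $\rho(H) < \rho(H')$. (c) Given $n, \kappa$, there exists a $\kappa$-connected path-complete graph of order $n$ and size $m$ if and only if $m \equiv \binom{n-1}{2} \pmod{\kappa}$ and \[\tfrac{1}{2} \big[n(3\kappa-1) - 2\kappa^2 - \kappa+1 - b(\kappa-b)\big] \leq m \leq \binom{n-1}{2},\] where $b$ is the integer in $\{1,2,\ldots, \kappa\}$ with $b \equiv n-1 \pmod{\kappa}$.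
   Context: All graphs are finite, simple and connected. For a connected graph $G$ of order $n\ge 2$ and a vertex $v$, $\sigma_G(v)=\sum_{w\in V(G)} d_G(v,w)$ and $\overline{\sigma}_G(v)=\sigma_G(v)/(n-1)$; the remoteness is $\rho(G)=\max_{v\in V(G)}\overline{\sigma}_G(v)$. $m(G)$ denotes the size (number of edges) of $G$. $K_n$ is the complete graph on $n$ vertices. For disjoint graphs $G_1,\dots,G_k$, the sequential sum $G_1+G_2+\cdots+G_k$ is obtained from their disjoint union by joining every vertex of $G_i$ to every vertex of $G_{i+1}$ for $i=1,\dots,k-1$; $[K_{\kappa}]^{\ell}$ denotes $\ell$ consecutive copies $K_\kappa+\cdots+K_\kappa$ in such a sequential sum. A graph is $\kappa$-connected if removing fewer than $\kappa$ vertices leaves it connected. A $\kappa$-connected path-complete graph is a graph of the form $K_1 + [K_{\kappa}]^{\ell} + K_a + K_b$ with $\ell, a, b$ positive integers and $a \geq \kappa$. -}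

module Defs where

open import Data.Nat using (ℕ; zero; suc; _+_; _∸_; _⊔_; _≤ᵇ_; _<ᵇ_)
open import Data.Bool using (Bool; true; false; _∧_; _∨_; not; if_then_else_)
open import Data.Fin using (Fin; toℕ; _≟_)
open import Data.List using (List; []; _∷_; _++_; map; foldr; replicate; allFin)
open import Data.Nat.ListAction using (sum)
open import Data.Bool.ListAction using (any)
open import Data.Integer using (+_)
open import Data.Rational using (ℚ; _/_; 0ℚ)
open import Relation.Nullary.Decidable using (⌊_⌋)

-- A (simple) graph on the vertex set Fin n, given by its Boolean adjacency
-- relation.  All graphs built below are symmetric and irreflexive.
Graph : ℕ → Set
Graph n = Fin n → Fin n → Bool

walk≤ : {n : ℕ} → Graph n → ℕ → Fin n → Fin n → Bool
walk≤ G zero    v w = ⌊ v ≟ w ⌋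
walk≤ {n} G (suc k) v w =
  walk≤ G k v w ∨ any (λ u → walk≤ G k v u ∧ G u w) (allFin n)

distSearch : {n : ℕ} → Graph n → Fin n → Fin n → ℕ → ℕ → ℕ
distSearch G v w i zero     = i
distSearch G v w i (suc f) =
  if walk≤ G i v w then i else distSearch G v w (suc i) f

-- Distance d_G(v,w): the length of a shortest v-w path
-- (for connected graphs it is < n; the value n is only used if w is unreachable).
dist : {n : ℕ} → Graph n → Fin n → Fin n → ℕ
dist {n} G v w = distSearch G v w 0 n

σ : {n : ℕ} → Graph n → Fin n → ℕ
σ {n} G v = sum (map (dist G v) (allFin n))

maxσ : {n : ℕ} → Graph n → ℕ
maxσ {n} G = foldr _⊔_ 0 (map (σ G) (allFin n))

-- remoteness ρ(G) = max_v σ_G(v)/(n-1)   (junk value 0 for n ≤ 1)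
ρ : {n : ℕ} → Graph n → ℚ
ρ {zero}        G = 0ℚ
ρ {suc zero}    G = 0ℚ
ρ {suc (suc k)} G = (+ maxσ G) / suc k

size : {n : ℕ} → Graph n → ℕ
size {n} G =
  sum (map (λ i → sum (map (λ j → if (toℕ i <ᵇ toℕ j) ∧ G i j then 1 else 0)
                           (allFin n)))
           (allFin n))

addEdge : {n : ℕ} → Graph n → Fin n → Fin n → Graph n
addEdge G u v x y = G x y ∨ (⌊ x ≟ u ⌋ ∧ ⌊ y ≟ v ⌋) ∨ (⌊ x ≟ v ⌋ ∧ ⌊ y ≟ u ⌋)

-- Sequential sum K_{s₀} + K_{s₁} + ⋯ + K_{s_k} of complete graphs.
-- Vertices 0 .. s₀-1 form the first clique, the next s₁ the second, etc.
-- blockOf ss t = index of the clique containing vertex number t.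
blockOf : List ℕ → ℕ → ℕ
blockOf []       t = 0
blockOf (s ∷ ss) t = if t <ᵇ s then 0 else suc (blockOf ss (t ∸ s))

seqSumK : (ss : List ℕ) → Graph (sum ss)
seqSumK ss i j =
  not ⌊ i ≟ j ⌋
  ∧ (blockOf ss (toℕ i) ≤ᵇ suc (blockOf ss (toℕ j)))
  ∧ (blockOf ss (toℕ j) ≤ᵇ suc (blockOf ss (toℕ i)))

pcSizes : ℕ → ℕ → ℕ → ℕ → List ℕ
pcSizes κ ℓ a b = 1 ∷ replicate ℓ κ ++ a ∷ b ∷ []

pathComplete : (κ ℓ a b : ℕ) → Graph (sum (pcSizes κ ℓ a b))
pathComplete κ ℓ a b = seqSumK (pcSizes κ ℓ a b)

{-# OPTIONS --safe #-}
module Submission where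

-- Two distinct vertices of K₁ + [K_κ]^ℓ + K_a + K_b lying in the cliques with indices i and j
-- are at distance max(1, |i − j|), so every transmission is an explicit polynomial in κ, ℓ, a, b.
-- The largest one, σ₀ = κ(1 + ⋯ + ℓ) + a(ℓ + 1) + b(ℓ + 2), is attained by the vertex of K₁ and
-- by no other vertex, except possibly the vertex of K_b when b = 1. A non-edge joins cliques at
-- distance at least 2 and shortens a geodesic from each of these vertices, which gives (a).
-- For (b), m + κσ₀ depends only on the order, and among graphs of the same order σ₀ determines
-- (ℓ, a, b). For (c), writing ℓ = ℓ′ + 1, a = κ + α, b = b′ + 1, the difference C(n − 1, 2) − m
-- is κ times an explicit deficit; if n − 1 = qκ + β then the deficits that occur are exactly
-- 0, 1, …, Y(q, β), and the lower bound of (c) is m ≥ C(n − 1, 2) − κ·Y(q, β) in disguise.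

open import Defs
open import Data.Bool using (Bool; true; false; T; not; _∧_; if_then_else_)
open import Data.Bool.Properties using (T-∧; T-∨; T-≡; ∧-identityʳ)
open import Data.Fin as Fin using (Fin; toℕ; _≟_; punchIn; fromℕ<)
open import Data.Fin.Properties using (punchInᵢ≢i; toℕ<n; toℕ-fromℕ<; toℕ-injective)
open import Data.Integer as ℤ using (ℤ; +≤+; +<+)
import Data.Integer.Properties as ℤ
import Data.Integer.Tactic.RingSolver as ℤ-Solver
open import Data.List using (List; []; _∷_; _++_; map; foldr; allFin; tabulate; length; replicate)
open import Data.List.Properties using (map-tabulate; ++-identityʳ; ++-assoc; length-++; length-replicate)
open import Data.List.Membership.Propositional using (_∈_; lose)
open import Data.List.Membership.Propositional.Properties using (∈-allFin)
open import Data.List.Relation.Unary.All using (All; []; _∷_)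
open import Data.List.Relation.Unary.Any using (here; there; satisfied)
open import Data.List.Relation.Unary.Any.Properties using (any⁺; any⁻)
open import Data.Nat as ℕ
  using (ℕ; zero; suc; NonZero; >-nonZero; _+_; _*_; _∸_; _⊔_; ∣_-_∣; _≤_; _<_; z≤n; s≤s; s≤s⁻¹; _<ᵇ_; _≤ᵇ_; _≤?_; >-nonZero⁻¹)
open import Data.Nat.Combinatorics using (_C_; nC1≡n; nCk+nC[k+1]≡[n+1]C[k+1])
open import Data.Nat.DivMod using (_%_; _/_; m≡m%n+[m/n]*n; n%n≡0; m<n⇒m%n≡m; [m+kn]%n≡m%n)
open import Data.Nat.ListAction using (sum)
open import Data.Nat.ListAction.Properties using (sum-++)
open import Data.Nat.Properties hiding (_≟_)
open import Algebra.Properties.CommutativeMonoid.Sum +-0-commutativeMonoid using (sum-syntax; sum-cong-≗; sum-remove)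
open import Data.Nat.Tactic.RingSolver using (solve-∀)
open import Data.Product using (Σ; ∃-syntax; _×_; _,_; proj₂)
import Data.Rational as ℚ
import Data.Rational.Properties as ℚ
open import Data.Rational.Unnormalised using (mkℚᵘ; *<*)
import Data.Rational.Unnormalised.Properties as ℚᵘ
open import Data.Sum using (_⊎_; inj₁; inj₂)
open import Function using (_∘_; id; _⇔_; mk⇔; Equivalence)
open import Relation.Binary.Definitions using (Tri; tri<; tri≈; tri>)
open import Relation.Binary.PropositionalEquality
open import Relation.Nullary using (¬_; yes; no; contradiction)
open import Relation.Nullary.Decidable using (⌊_⌋; fromWitness; toWitness; fromWitnessFalse; toWitnessFalse)

open Equivalence using (to; from)

sum-tabulate : ∀ n (f : Fin n → ℕ) → sum (tabulate f) ≡ ∑[ i < n ] f i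
sum-tabulate zero    f = refl
sum-tabulate (suc n) f = cong (f Fin.zero +_) (sum-tabulate n (f ∘ Fin.suc))

sum-map-allFin : ∀ n (f : Fin n → ℕ) → sum (map f (allFin n)) ≡ ∑[ i < n ] f i
sum-map-allFin n f = trans (cong sum (map-tabulate id f)) (sum-tabulate n f)

∑-punctured : ∀ {n} (f g : Fin n → ℕ) v {d} → (∀ w → w ≢ v → f w ≡ g w) → f v + d ≡ g v →
              ∑[ i < n ] f i + d ≡ ∑[ i < n ] g i
∑-punctured {suc n} f g v {d} agree fv+d≡gv = begin
  ∑[ i < suc n ] f i + d                         ≡⟨ cong (_+ d) (sum-remove f) ⟩
  f v + ∑[ i < n ] f (punchIn v i) + d           ≡⟨ +-assoc (f v) _ d ⟩
  f v + (∑[ i < n ] f (punchIn v i) + d)         ≡⟨ cong (f v +_) (+-comm _ d) ⟩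
  f v + (d + ∑[ i < n ] f (punchIn v i))         ≡⟨ sym (+-assoc (f v) d _) ⟩
  f v + d + ∑[ i < n ] f (punchIn v i)           ≡⟨ cong₂ _+_ fv+d≡gv (sum-cong-≗ (λ i → agree _ (punchInᵢ≢i v i))) ⟩
  g v + ∑[ i < n ] g (punchIn v i)               ≡⟨ sum-remove g ⟨
  ∑[ i < suc n ] g i                             ∎
  where open ≡-Reasoning

module _ {A : Set} {f g : A → ℕ} (f≤g : ∀ x → f x ≤ g x) where

  sum-map-mono-≤ : ∀ xs → sum (map f xs) ≤ sum (map g xs)
  sum-map-mono-≤ []       = z≤n
  sum-map-mono-≤ (x ∷ xs) = +-mono-≤ (f≤g x) (sum-map-mono-≤ xs)

  sum-map-mono-< : ∀ {x xs} → x ∈ xs → f x < g x → sum (map f xs) < sum (map g xs)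
  sum-map-mono-< {xs = _ ∷ xs} (here refl) fx<gx = +-mono-<-≤ fx<gx (sum-map-mono-≤ xs)
  sum-map-mono-< {xs = y ∷ _}  (there x∈xs) fx<gx = +-mono-≤-< (f≤g y) (sum-map-mono-< x∈xs fx<gx)

module _ {A : Set} (f : A → ℕ) where

  ≤-foldr-⊔ : ∀ {x xs} → x ∈ xs → f x ≤ foldr _⊔_ 0 (map f xs)
  ≤-foldr-⊔ {xs = y ∷ xs} (here refl)  = m≤m⊔n (f y) _
  ≤-foldr-⊔ {xs = y ∷ xs} (there x∈xs) = ≤-trans (≤-foldr-⊔ x∈xs) (m≤n⊔m (f y) _)

  foldr-⊔-≤ : ∀ {c} → (∀ x → f x ≤ c) → ∀ xs → foldr _⊔_ 0 (map f xs) ≤ c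
  foldr-⊔-≤ f≤c []       = z≤n
  foldr-⊔-≤ f≤c (x ∷ xs) = ⊔-lub (f≤c x) (foldr-⊔-≤ f≤c xs)

  foldr-⊔-< : ∀ {c} → 0 < c → (∀ x → f x < c) → ∀ xs → foldr _⊔_ 0 (map f xs) < c
  foldr-⊔-< 0<c f<c []       = 0<c
  foldr-⊔-< 0<c f<c (x ∷ xs) = ⊔-lub (f<c x) (foldr-⊔-< 0<c f<c xs)

sumBelow : ℕ → (ℕ → ℕ) → ℕ
sumBelow zero    g = 0
sumBelow (suc n) g = g 0 + sumBelow n (g ∘ suc)

∑-toℕ : ∀ n (g : ℕ → ℕ) → ∑[ i < n ] g (toℕ i) ≡ sumBelow n g
∑-toℕ zero    g = refl
∑-toℕ (suc n) g = cong (g 0 +_) (∑-toℕ n (g ∘ suc))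

sumBelow-cong< : ∀ n {f g : ℕ → ℕ} → (∀ {t} → t < n → f t ≡ g t) → sumBelow n f ≡ sumBelow n g
sumBelow-cong< zero    f≡g = refl
sumBelow-cong< (suc n) f≡g = cong₂ _+_ (f≡g (s≤s z≤n)) (sumBelow-cong< n (f≡g ∘ s≤s))

sumBelow-cong : ∀ n {f g : ℕ → ℕ} → (∀ t → f t ≡ g t) → sumBelow n f ≡ sumBelow n g
sumBelow-cong n f≡g = sumBelow-cong< n (λ {t} _ → f≡g t)

sumBelow-+ : ∀ m k (g : ℕ → ℕ) → sumBelow (m + k) g ≡ sumBelow m g + sumBelow k (λ t → g (m + t))
sumBelow-+ zero    k g = refl
sumBelow-+ (suc m) k g = trans (cong (g 0 +_) (sumBelow-+ m k (g ∘ suc))) (sym (+-assoc (g 0) _ _))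

sumBelow-const : ∀ n c → sumBelow n (λ _ → c) ≡ n * c
sumBelow-const zero    c = refl
sumBelow-const (suc n) c = cong (c +_) (sumBelow-const n c)

sumBelow-distrib-+ : ∀ n (f g : ℕ → ℕ) → sumBelow n (λ t → f t + g t) ≡ sumBelow n f + sumBelow n g
sumBelow-distrib-+ zero    f g = refl
sumBelow-distrib-+ (suc n) f g =
  trans (cong (f 0 + g 0 +_) (sumBelow-distrib-+ n (f ∘ suc) (g ∘ suc))) (+-+-comm (f 0) (g 0) _ _)
  where
  +-+-comm : ∀ a b c d → a + b + (c + d) ≡ a + c + (b + d)
  +-+-comm = solve-∀

sumBelow-suc : ∀ n (g : ℕ → ℕ) → sumBelow (suc n) g ≡ sumBelow n g + g n
sumBelow-suc zero    g = +-identityʳ (g 0)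
sumBelow-suc (suc n) g = trans (cong (g 0 +_) (sumBelow-suc n (g ∘ suc))) (sym (+-assoc (g 0) _ _))

choose2 : ℕ → ℕ
choose2 zero    = 0
choose2 (suc n) = n + choose2 n

sumBelow[suc]≡choose2 : ∀ n → sumBelow n suc ≡ choose2 (suc n)
sumBelow[suc]≡choose2 zero    = refl
sumBelow[suc]≡choose2 (suc n) =
  trans (sumBelow-suc n suc) (trans (cong (_+ suc n) (sumBelow[suc]≡choose2 n)) (+-comm _ (suc n)))

choose2-+ : ∀ m n → choose2 (m + n) ≡ choose2 m + choose2 n + m * n
choose2-+ zero    n = sym (+-identityʳ (choose2 n))
choose2-+ (suc m) n = trans (cong (m + n +_) (choose2-+ m n)) (lemma m n (choose2 m) (choose2 n))
  where
  lemma : ∀ m n cm cn → m + n + (cm + cn + m * n) ≡ m + cm + cn + suc m * n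
  lemma = solve-∀

choose2-* : ∀ m k → choose2 (m * k) ≡ m * choose2 k + k * k * choose2 m
choose2-* zero    k = sym (*-zeroʳ (k * k))
choose2-* (suc m) k = trans (choose2-+ k (m * k))
  (trans (cong (λ c → choose2 k + c + k * (m * k)) (choose2-* m k)) (lemma m k (choose2 k) (choose2 m)))
  where
  lemma : ∀ m k ck cm → ck + (m * ck + k * k * cm) + k * (m * k) ≡ suc m * ck + k * k * (m + cm)
  lemma = solve-∀

C2≡choose2 : ∀ x → x C 2 ≡ choose2 x
C2≡choose2 zero    = refl
C2≡choose2 (suc x) = trans (sym (nCk+nC[k+1]≡[n+1]C[k+1] x 1)) (cong₂ _+_ (nC1≡n x) (C2≡choose2 x))

choose2-double : ∀ x → choose2 x + choose2 x + x ≡ x * x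
choose2-double zero    = refl
choose2-double (suc x) = trans (regroup x (choose2 x)) (trans (cong (_+ (x + x + 1)) (choose2-double x)) (square x))
  where
  regroup : ∀ x c → x + c + (x + c) + suc x ≡ c + c + x + (x + x + 1)
  regroup = solve-∀
  square : ∀ x → x * x + (x + x + 1) ≡ suc x * suc x
  square = solve-∀

module Walks {n : ℕ} (G : Graph n) where

  walk≤-suc : ∀ k v w → T (walk≤ G k v w) → T (walk≤ G (suc k) v w)
  walk≤-suc k v w p = from (T-∨ {walk≤ G k v w}) (inj₁ p)

  walk≤-mono : ∀ {j} k v w → j ≤ k → T (walk≤ G j v w) → T (walk≤ G k v w)
  walk≤-mono zero    v w z≤n p = p
  walk≤-mono (suc k) v w j≤1+k p with m≤n⇒m<n∨m≡n j≤1+k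
  ... | inj₁ j<1+k = walk≤-suc k v w (walk≤-mono k v w (s≤s⁻¹ j<1+k) p)
  ... | inj₂ refl  = p

  walk≤-refl : ∀ k v → T (walk≤ G k v v)
  walk≤-refl k v = walk≤-mono k v v z≤n (fromWitness refl)

  walk≤-zero : ∀ v w → T (walk≤ G 0 v w) → v ≡ w
  walk≤-zero v w = toWitness

  walk≤-step : ∀ k v u w → T (walk≤ G k v u) → T (G u w) → T (walk≤ G (suc k) v w)
  walk≤-step k v u w p e = from (T-∨ {walk≤ G k v w})
    (inj₂ (any⁺ _ (lose (∈-allFin u) (from (T-∧ {walk≤ G k v u}) (p , e)))))

  walk≤-last : ∀ k v w → T (walk≤ G (suc k) v w) →
               T (walk≤ G k v w) ⊎ ∃[ u ] (T (walk≤ G k v u) × T (G u w))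
  walk≤-last k v w p with to (T-∨ {walk≤ G k v w}) p
  ... | inj₁ q = inj₁ q
  ... | inj₂ q with satisfied (any⁻ _ (allFin n) q)
  ...   | u , r = inj₂ (u , to (T-∧ {walk≤ G k v u}) r)

  walk≤-lipschitz : (f : Fin n → ℕ) → (∀ u w → T (G u w) → ∣ f u - f w ∣ ≤ 1) →
                    ∀ k v w → T (walk≤ G k v w) → ∣ f v - f w ∣ ≤ k
  walk≤-lipschitz f edge zero v w p rewrite walk≤-zero v w p = ≤-reflexive (∣n-n∣≡0 (f w))
  walk≤-lipschitz f edge (suc k) v w p with walk≤-last k v w p
  ... | inj₁ q           = m≤n⇒m≤1+n (walk≤-lipschitz f edge k v w q)
  ... | inj₂ (u , q , e) = begin
    ∣ f v - f w ∣                 ≤⟨ ∣-∣-triangle (f v) (f u) (f w) ⟩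
    ∣ f v - f u ∣ + ∣ f u - f w ∣ ≤⟨ +-mono-≤ (walk≤-lipschitz f edge k v u q) (edge u w e) ⟩
    k + 1                         ≡⟨ +-comm k 1 ⟩
    suc k                         ∎
    where open ≤-Reasoning

  walk≤-distinct : ∀ {v w} → v ≢ w → ∀ j → T (walk≤ G j v w) → 1 ≤ j
  walk≤-distinct v≢w zero    p = contradiction (walk≤-zero _ _ p) v≢w
  walk≤-distinct v≢w (suc j) p = s≤s z≤n

  private
    distSearch-≤ : ∀ {k v w} i f → T (walk≤ G k v w) → i ≤ k → distSearch G v w i f ≤ k
    distSearch-≤ i zero    p i≤k = i≤k
    distSearch-≤ {k} {v} {w} i (suc f) p i≤k with walk≤ G i v w in eq
    ... | true  = i≤k
    ... | false = distSearch-≤ (suc i) f p (≤∧≢⇒< i≤k λ { refl → subst T eq p })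

    ≤-distSearch : ∀ {k v w} i f → (∀ j → T (walk≤ G j v w) → k ≤ j) → k ≤ i + f →
                   k ≤ distSearch G v w i f
    ≤-distSearch i zero    walk⇒k≤ k≤i = subst (_ ≤_) (+-identityʳ i) k≤i
    ≤-distSearch {k} {v} {w} i (suc f) walk⇒k≤ k≤i+f with walk≤ G i v w in eq
    ... | true  = walk⇒k≤ i (subst T (sym eq) _)
    ... | false = ≤-distSearch (suc i) f walk⇒k≤ (subst (k ≤_) (+-suc i f) k≤i+f)

  dist-≤ : ∀ {k} v w → T (walk≤ G k v w) → dist G v w ≤ k
  dist-≤ v w p = distSearch-≤ 0 n p z≤n

  ≤-dist : ∀ {k} v w → (∀ j → T (walk≤ G j v w) → k ≤ j) → k ≤ n → k ≤ dist G v w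
  ≤-dist v w = ≤-distSearch 0 n

walk≤-⊆ : ∀ {n} {G G′ : Graph n} → (∀ x y → T (G x y) → T (G′ x y)) →
          ∀ k v w → T (walk≤ G k v w) → T (walk≤ G′ k v w)
walk≤-⊆ G⊆G′ zero    v w p = p
walk≤-⊆ {G = G} {G′} G⊆G′ (suc k) v w p with Walks.walk≤-last G k v w p
... | inj₁ q           = Walks.walk≤-suc G′ k v w (walk≤-⊆ G⊆G′ k v w q)
... | inj₂ (u , q , e) = Walks.walk≤-step G′ k v u w (walk≤-⊆ G⊆G′ k v u q) (G⊆G′ u w e)

blockOf-< : ∀ {s} ss {t} → t < s → blockOf (s ∷ ss) t ≡ 0
blockOf-< ss t<s rewrite to T-≡ (<⇒<ᵇ t<s) = refl

blockOf-+ : ∀ s ss t → blockOf (s ∷ ss) (s + t) ≡ suc (blockOf ss t)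
blockOf-+ s ss t with s + t <ᵇ s in eq
... | true  = contradiction (<ᵇ⇒< (s + t) s (subst T (sym eq) _)) (≤⇒≯ (m≤m+n s t))
... | false = cong (suc ∘ blockOf ss) (m+n∸m≡n s t)

blockOf-++ : ∀ xs ys {t} → t < sum xs → blockOf (xs ++ ys) t < length xs
blockOf-++ (s ∷ xs) ys {t} t<s+xs with t <ᵇ s in eq
... | true  = s≤s z≤n
... | false = s≤s (blockOf-++ xs ys (+-cancelˡ-< s _ _ (subst (_< s + sum xs) (sym (m+[n∸m]≡n s≤t)) t<s+xs)))
  where
  s≤t : s ≤ t
  s≤t = ≮⇒≥ (λ t<s → subst T eq (<⇒<ᵇ t<s))

blockOf<length : ∀ ss {t} → t < sum ss → blockOf ss t < length ss
blockOf<length ss {t} t<n = subst (λ xs → blockOf xs t < length ss) (++-identityʳ ss) (blockOf-++ ss [] t<n)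

blockOf-++-≥ : ∀ xs ys {t} → length xs ≤ blockOf (xs ++ ys) t → sum xs ≤ t
blockOf-++-≥ xs ys {t} len≤ = ≮⇒≥ (λ t<sum → <⇒≱ (blockOf-++ xs ys t<sum) len≤)

blockOf-surjective : ∀ {ss} → All (1 ≤_) ss → ∀ {r} → r < length ss → ∃[ t ] t < sum ss × blockOf ss t ≡ r
blockOf-surjective {s ∷ ss} (1≤s ∷ _)   {zero}  _ = 0 , ≤-trans 1≤s (m≤m+n s _) , blockOf-< ss 1≤s
blockOf-surjective {s ∷ ss} (_ ∷ pos) {suc r} (s≤s r<len) with blockOf-surjective pos r<len
... | t , t<n , refl = s + t , +-monoʳ-< s t<n , blockOf-+ s ss t

length≤sum : ∀ {ss} → All (1 ≤_) ss → length ss ≤ sum ss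
length≤sum []          = z≤n
length≤sum (1≤s ∷ pos) = +-mono-≤ 1≤s (length≤sum pos)

weightedSum : List ℕ → (ℕ → ℕ) → ℕ
weightedSum []       g = 0
weightedSum (s ∷ ss) g = s * g 0 + weightedSum ss (g ∘ suc)

sumBelow-blockOf : ∀ ss (g : ℕ → ℕ) → sumBelow (sum ss) (g ∘ blockOf ss) ≡ weightedSum ss g
sumBelow-blockOf []       g = refl
sumBelow-blockOf (s ∷ ss) g = begin
  sumBelow (s + sum ss) (g ∘ blockOf (s ∷ ss))
    ≡⟨ sumBelow-+ s (sum ss) _ ⟩
  sumBelow s (g ∘ blockOf (s ∷ ss)) + sumBelow (sum ss) (λ t → g (blockOf (s ∷ ss) (s + t)))
    ≡⟨ cong₂ _+_ (sumBelow-cong< s (cong g ∘ blockOf-< ss)) (sumBelow-cong (sum ss) (cong g ∘ blockOf-+ s ss)) ⟩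
  sumBelow s (λ _ → g 0) + sumBelow (sum ss) (g ∘ suc ∘ blockOf ss)
    ≡⟨ cong₂ _+_ (sumBelow-const s (g 0)) (sumBelow-blockOf ss (g ∘ suc)) ⟩
  s * g 0 + weightedSum ss (g ∘ suc)
    ∎
  where open ≡-Reasoning

∣-∣≤⇔ : ∀ {m n k} → ∣ m - n ∣ ≤ k ⇔ (m ≤ k + n × n ≤ k + m)
∣-∣≤⇔ {m} {n} {k} = mk⇔ elim intro
  where
  elim : ∣ m - n ∣ ≤ k → m ≤ k + n × n ≤ k + m
  elim d≤k = ≤-trans (m≤∣m-n∣+n m n) (+-monoˡ-≤ n d≤k)
           , ≤-trans (m≤∣m-n∣+n n m) (+-monoˡ-≤ m (subst (_≤ k) (∣-∣-comm m n) d≤k))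
  intro : m ≤ k + n × n ≤ k + m → ∣ m - n ∣ ≤ k
  intro (m≤k+n , n≤k+m) with ∣m-n∣≡[m∸n]∨[n∸m] m n
  ... | inj₁ d≡m∸n = subst (_≤ k) (sym d≡m∸n) (m≤n+o⇒m∸n≤o m n (subst (m ≤_) (+-comm k n) m≤k+n))
  ... | inj₂ d≡n∸m = subst (_≤ k) (sym d≡n∸m) (m≤n+o⇒m∸n≤o n m (subst (n ≤_) (+-comm k m) n≤k+m))

∣n-1+n∣≡1 : ∀ n → ∣ n - suc n ∣ ≡ 1
∣n-1+n∣≡1 zero    = refl
∣n-1+n∣≡1 (suc n) = ∣n-1+n∣≡1 n

∣-∣-step : ∀ p q → 2 ≤ ∣ p - q ∣ → ∃[ r ] ∣ r - q ∣ ≡ 1 × suc ∣ p - r ∣ ≡ ∣ p - q ∣ × r < p ⊔ q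
∣-∣-step zero          (suc (suc q)) _   = suc q , ∣n-1+n∣≡1 q , refl , n<1+n (suc q)
∣-∣-step (suc (suc p)) zero          _   = 1 , refl , refl , s≤s (s≤s z≤n)
∣-∣-step (suc p)       (suc q)       gap with ∣-∣-step p q gap
... | r , r~q , steps , r< = suc r , r~q , steps , s≤s r<
∣-∣-step zero          zero          ()
∣-∣-step zero          (suc zero)    (s≤s ())
∣-∣-step (suc zero)    zero          (s≤s ())

blockDist : ℕ → ℕ → ℕ
blockDist p q = 1 ⊔ ∣ p - q ∣

blockDist-self : ∀ p → blockDist p p ≡ 1
blockDist-self p = cong (1 ⊔_) (∣n-n∣≡0 p)

blockDist-least : ∀ p q {j} → 1 ≤ j → ∣ p - q ∣ ≤ j → blockDist p q ≤ j
blockDist-least p q = ⊔-lub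

blockDist-< : ∀ {p q L} → p < L → q < L → blockDist p q ≤ L
blockDist-< {p} {q} {L} p<L q<L = ⊔-lub (≤-trans (s≤s z≤n) p<L)
  (from ∣-∣≤⇔ (≤-trans (<⇒≤ p<L) (m≤m+n L q) , ≤-trans (<⇒≤ q<L) (m≤m+n L p)))

blockDist-+ : ∀ j t → blockDist j (j + suc t) ≡ suc t
blockDist-+ j t = cong (1 ⊔_) (∣m-m+n∣≡n j (suc t))

blockDist-suc : ∀ m → blockDist m (suc m) ≡ 1
blockDist-suc m = cong (1 ⊔_) (∣n-1+n∣≡1 m)

blockDist-sym : ∀ p q → blockDist p q ≡ blockDist q p
blockDist-sym p q = cong (1 ⊔_) (∣-∣-comm p q)

sumBelow-blockDist : ∀ m → sumBelow m (blockDist m) ≡ choose2 (suc m)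
sumBelow-blockDist zero    = refl
sumBelow-blockDist (suc m) = cong (suc m +_) (sumBelow-blockDist m)

sumBelow-blockDist-suc : ∀ m → sumBelow m (blockDist (suc m)) ≡ m + choose2 (suc m)
sumBelow-blockDist-suc zero    = refl
sumBelow-blockDist-suc (suc m) = begin
  suc (suc m) + sumBelow m (blockDist (suc m)) ≡⟨ cong (suc (suc m) +_) (sumBelow-blockDist-suc m) ⟩
  suc (suc m) + (m + choose2 (suc m))          ≡⟨ lemma m (choose2 (suc m)) ⟩
  suc m + (suc m + choose2 (suc m))            ∎
  where
  open ≡-Reasoning
  lemma : ∀ m c → suc (suc m) + (m + c) ≡ suc m + (suc m + c)
  lemma = solve-∀

module SequentialSum (ss : List ℕ) (pos : All (1 ≤_) ss) where

  n : ℕ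
  n = sum ss

  H : Graph n
  H = seqSumK ss

  B : Fin n → ℕ
  B v = blockOf ss (toℕ v)

  open Walks H

  B<length : ∀ v → B v < length ss
  B<length v = blockOf<length ss (toℕ<n v)

  block-surjective : ∀ {r} → r < length ss → ∃[ u ] B u ≡ r
  block-surjective r<len with blockOf-surjective pos r<len
  ... | t , t<n , eq = fromℕ< t<n , trans (cong (blockOf ss) (toℕ-fromℕ< t<n)) eq

  adjacent⇔ : ∀ {v w} → T (H v w) ⇔ (v ≢ w × ∣ B v - B w ∣ ≤ 1)
  adjacent⇔ {v} {w} = mk⇔ elim intro
    where
    distinct = not ⌊ v ≟ w ⌋
    up       = B v ≤ᵇ suc (B w)
    down     = B w ≤ᵇ suc (B v)
    elim : T (H v w) → v ≢ w × ∣ B v - B w ∣ ≤ 1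
    elim e with to (T-∧ {distinct}) e
    ... | v≢w , near with to (T-∧ {up}) near
    ...   | ≤up , ≤down = toWitnessFalse v≢w
                        , from (∣-∣≤⇔ {B v} {B w}) (≤ᵇ⇒≤ (B v) (suc (B w)) ≤up , ≤ᵇ⇒≤ (B w) (suc (B v)) ≤down)
    intro : v ≢ w × ∣ B v - B w ∣ ≤ 1 → T (H v w)
    intro (v≢w , near) with to (∣-∣≤⇔ {B v} {B w}) near
    ... | ≤up , ≤down = from (T-∧ {distinct}) (fromWitnessFalse v≢w , from (T-∧ {up}) (≤⇒≤ᵇ ≤up , ≤⇒≤ᵇ ≤down))

  walk≤-blocks : ∀ k v w → ∣ B v - B w ∣ ≤ k → v ≡ w ⊎ 1 ≤ k → T (walk≤ H k v w)
  walk≤-blocks zero    v .v _    (inj₁ refl) = walk≤-refl 0 v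
  walk≤-blocks (suc k) v w  gap≤ _ with v ≟ w | ∣ B v - B w ∣ ≤? 1
  ... | yes refl | _         = walk≤-refl (suc k) v
  ... | no v≢w   | yes near  = walk≤-mono (suc k) v w (s≤s z≤n) (walk≤-step 0 v v w (walk≤-refl 0 v) (from adjacent⇔ (v≢w , near)))
  ... | no _     | no far with ∣-∣-step (B v) (B w) (≰⇒> far)
  ...   | r , r~w , steps , r<max with block-surjective (<-trans r<max (⊔-lub (B<length v) (B<length w)))
  ...     | u , refl = walk≤-step k v u w (walk≤-blocks k v u gap′≤k (inj₂ (≤-trans 1≤gap′ gap′≤k)))
                                          (from adjacent⇔ (u≢w , ≤-reflexive r~w))
    where
    gap′≤k : ∣ B v - B u ∣ ≤ k
    gap′≤k = s≤s⁻¹ (subst (_≤ suc k) (sym steps) gap≤)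
    1≤gap′ : 1 ≤ ∣ B v - B u ∣
    1≤gap′ = s≤s⁻¹ (subst (2 ≤_) (sym steps) (≰⇒> far))
    u≢w : u ≢ w
    u≢w refl = 0≢1+n (trans (sym (∣n-n∣≡0 (B u))) r~w)

  walk≤-blockDist : ∀ v w → T (walk≤ H (blockDist (B v) (B w)) v w)
  walk≤-blockDist v w = walk≤-blocks _ v w (m≤n⊔m 1 ∣ B v - B w ∣) (inj₂ (m≤m⊔n 1 ∣ B v - B w ∣))

  dist-blocks : ∀ v w → v ≢ w → dist H v w ≡ blockDist (B v) (B w)
  dist-blocks v w v≢w = ≤-antisym (dist-≤ v w (walk≤-blockDist v w)) (≤-dist v w blockDist≤ blockDist≤n)
    where
    blockDist≤ : ∀ j → T (walk≤ H j v w) → blockDist (B v) (B w) ≤ j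
    blockDist≤ j p = blockDist-least (B v) (B w) (walk≤-distinct v≢w j p)
                                     (walk≤-lipschitz B (λ x y → proj₂ ∘ to adjacent⇔) j v w p)
    blockDist≤n : blockDist (B v) (B w) ≤ n
    blockDist≤n = ≤-trans (blockDist-< (B<length v) (B<length w)) (length≤sum pos)

  dist-self : ∀ v → dist H v v ≡ 0
  dist-self v = n≤0⇒n≡0 (dist-≤ v v (walk≤-refl 0 v))

  σ-blocks : ∀ v → σ H v + 1 ≡ weightedSum ss (blockDist (B v))
  σ-blocks v = begin
    σ H v + 1                                     ≡⟨ cong (_+ 1) (sum-map-allFin n (dist H v)) ⟩
    ∑[ w < n ] dist H v w + 1                     ≡⟨ ∑-punctured (dist H v) (blockDist (B v) ∘ B) v agree self ⟩
    ∑[ w < n ] blockDist (B v) (B w)              ≡⟨ ∑-toℕ n (blockDist (B v) ∘ blockOf ss) ⟩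
    sumBelow n (blockDist (B v) ∘ blockOf ss)     ≡⟨ sumBelow-blockOf ss (blockDist (B v)) ⟩
    weightedSum ss (blockDist (B v))              ∎
    where
    open ≡-Reasoning
    agree : ∀ w → w ≢ v → dist H v w ≡ blockDist (B v) (B w)
    agree w w≢v = dist-blocks v w (w≢v ∘ sym)
    self : dist H v v + 1 ≡ blockDist (B v) (B v)
    self = trans (cong (_+ 1) (dist-self v)) (sym (blockDist-self (B v)))

  module Supergraph (G′ : Graph n) (H⊆G′ : ∀ x y → T (H x y) → T (G′ x y)) where

    dist-⊇ : ∀ v w → dist G′ v w ≤ dist H v w
    dist-⊇ v w with v ≟ w
    ... | yes refl = ≤-trans (Walks.dist-≤ G′ v v (Walks.walk≤-refl G′ 0 v)) z≤n
    ... | no v≢w   = subst (dist G′ v w ≤_) (sym (dist-blocks v w v≢w))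
                       (Walks.dist-≤ G′ v w (walk≤-⊆ H⊆G′ (blockDist (B v) (B w)) v w (walk≤-blockDist v w)))

    σ-⊇ : ∀ v → σ G′ v ≤ σ H v
    σ-⊇ v = sum-map-mono-≤ (dist-⊇ v) (allFin n)

    σ-⊇-< : ∀ v w → dist G′ v w < dist H v w → σ G′ v < σ H v
    σ-⊇-< v w = sum-map-mono-< (dist-⊇ v) (∈-allFin w)

    shortcut : ∀ z x y → T (G′ x y) → (B z ≡ B x → z ≡ x) → suc ∣ B z - B x ∣ < ∣ B z - B y ∣ →
               dist G′ z y < dist H z y
    shortcut z x y x~y unique far = begin-strict
      dist G′ z y           ≤⟨ Walks.dist-≤ G′ z y (Walks.walk≤-step G′ ∣ B z - B x ∣ z x y z⇝x x~y) ⟩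
      suc ∣ B z - B x ∣     <⟨ far ⟩
      ∣ B z - B y ∣         ≤⟨ m≤n⊔m 1 _ ⟩
      blockDist (B z) (B y) ≡⟨ dist-blocks z y z≢y ⟨
      dist H z y            ∎
      where
      open ≤-Reasoning
      near : z ≡ x ⊎ 1 ≤ ∣ B z - B x ∣
      near with ∣ B z - B x ∣ in eq
      ... | zero  = inj₁ (unique (∣m-n∣≡0⇒m≡n eq))
      ... | suc _ = inj₂ (s≤s z≤n)
      z⇝x : T (walk≤ G′ ∣ B z - B x ∣ z x)
      z⇝x = walk≤-⊆ H⊆G′ ∣ B z - B x ∣ z x (walk≤-blocks ∣ B z - B x ∣ z x ≤-refl near)
      z≢y : z ≢ y
      z≢y refl = n≮0 (subst (suc ∣ B z - B x ∣ <_) (∣n-n∣≡0 (B z)) far)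

weightedSum-pcSizes : ∀ κ ℓ a b (g : ℕ → ℕ) → weightedSum (pcSizes κ ℓ a b) g ≡
                      g 0 + (κ * sumBelow ℓ (g ∘ suc) + a * g (suc ℓ) + b * g (2 + ℓ))
weightedSum-pcSizes κ ℓ a b g = cong₂ _+_ (*-identityˡ (g 0)) (tail ℓ (g ∘ suc))
  where
  tail : ∀ ℓ (h : ℕ → ℕ) → weightedSum (replicate ℓ κ ++ a ∷ b ∷ []) h ≡ κ * sumBelow ℓ h + a * h ℓ + b * h (suc ℓ)
  tail zero    h = lemma κ a b (h 0) (h 1)
    where
    lemma : ∀ κ a b x y → a * x + (b * y + 0) ≡ κ * 0 + a * x + b * y
    lemma = solve-∀
  tail (suc ℓ) h = trans (cong (κ * h 0 +_) (tail ℓ (h ∘ suc)))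
                         (lemma κ a b (h 0) (sumBelow ℓ (h ∘ suc)) (h (suc ℓ)) (h (2 + ℓ)))
    where
    lemma : ∀ κ a b x s y z → κ * x + (κ * s + a * y + b * z) ≡ κ * (x + s) + a * y + b * z
    lemma = solve-∀

maxTransmission : ℕ → ℕ → ℕ → ℕ → ℕ
maxTransmission κ ℓ a b = κ * choose2 (suc ℓ) + a * suc ℓ + b * suc (suc ℓ)

weightedSum-first : ∀ κ ℓ a b → weightedSum (pcSizes κ ℓ a b) (blockDist 0) ≡ suc (maxTransmission κ ℓ a b)
weightedSum-first κ ℓ a b = trans (weightedSum-pcSizes κ ℓ a b (blockDist 0))
  (cong (λ s → suc (κ * s + a * suc ℓ + b * suc (suc ℓ))) (sumBelow[suc]≡choose2 ℓ))

weightedSum-inner : ∀ κ j k a b′ →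
  weightedSum (pcSizes κ (j + suc k) a (suc b′)) (blockDist (suc j)) + suc (κ * (j * k + j + k) + a * suc j + b′ * suc j)
  ≡ suc (maxTransmission κ (j + suc k) a (suc b′))
weightedSum-inner κ j k a b′ = begin
  weightedSum (pcSizes κ ℓ a (suc b′)) (blockDist (suc j)) + slack
    ≡⟨ cong (_+ slack) (weightedSum-pcSizes κ ℓ a (suc b′) (blockDist (suc j))) ⟩
  shape (sumBelow ℓ (blockDist j)) (blockDist j ℓ) (blockDist j (suc ℓ))
    ≡⟨ cong (λ s → shape s (blockDist j ℓ) (blockDist j (suc ℓ))) distances ⟩
  shape (choose2 (suc j) + suc (choose2 (suc k))) (blockDist j ℓ) (blockDist j (suc ℓ))
    ≡⟨ cong (λ d → shape (choose2 (suc j) + suc (choose2 (suc k))) d (blockDist j (suc ℓ))) (blockDist-+ j k) ⟩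
  shape (choose2 (suc j) + suc (choose2 (suc k))) (suc k) (blockDist j (suc ℓ))
    ≡⟨ cong (shape (choose2 (suc j) + suc (choose2 (suc k))) (suc k))
            (trans (cong (blockDist j) (sym (+-suc j (suc k)))) (blockDist-+ j (suc k))) ⟩
  shape (choose2 (suc j) + suc (choose2 (suc k))) (suc k) (suc (suc k))
    ≡⟨ lemma κ j k a b′ (choose2 (suc j)) (choose2 (suc k)) ⟩
  suc (κ * (choose2 (suc j) + choose2 (suc k) + suc j * suc k) + a * suc ℓ + suc b′ * suc (suc ℓ))
    ≡⟨ cong (λ c → suc (κ * c + a * suc ℓ + suc b′ * suc (suc ℓ))) (choose2-+ (suc j) (suc k)) ⟨
  suc (maxTransmission κ ℓ a (suc b′))
    ∎
  where
  open ≡-Reasoning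
  ℓ = j + suc k
  slack = suc (κ * (j * k + j + k) + a * suc j + b′ * suc j)
  shape : ℕ → ℕ → ℕ → ℕ
  shape s d e = suc j + (κ * s + a * d + suc b′ * e) + slack
  distances : sumBelow ℓ (blockDist j) ≡ choose2 (suc j) + suc (choose2 (suc k))
  distances = begin
    sumBelow (j + suc k) (blockDist j)
      ≡⟨ sumBelow-+ j (suc k) (blockDist j) ⟩
    sumBelow j (blockDist j) + (blockDist j (j + 0) + sumBelow k (λ t → blockDist j (j + suc t)))
      ≡⟨ cong₂ (λ s d → s + (d + sumBelow k (λ t → blockDist j (j + suc t))))
               (sumBelow-blockDist j) (trans (cong (blockDist j) (+-identityʳ j)) (blockDist-self j)) ⟩
    choose2 (suc j) + suc (sumBelow k (λ t → blockDist j (j + suc t)))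
      ≡⟨ cong (λ s → choose2 (suc j) + suc s) (trans (sumBelow-cong k (blockDist-+ j)) (sumBelow[suc]≡choose2 k)) ⟩
    choose2 (suc j) + suc (choose2 (suc k))
      ∎
  lemma : ∀ κ j k a b′ cj ck →
    suc j + (κ * (cj + suc ck) + a * suc k + suc b′ * suc (suc k)) + suc (κ * (j * k + j + k) + a * suc j + b′ * suc j)
    ≡ suc (κ * (cj + ck + suc j * suc k) + a * suc (j + suc k) + suc b′ * suc (suc (j + suc k)))
  lemma = solve-∀

weightedSum-penultimate : ∀ κ ℓ a b′ →
  weightedSum (pcSizes κ ℓ a (suc b′)) (blockDist (suc ℓ)) + suc (a * ℓ + b′ * suc ℓ) ≡ suc (maxTransmission κ ℓ a (suc b′))
weightedSum-penultimate κ ℓ a b′ = begin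
  weightedSum (pcSizes κ ℓ a (suc b′)) (blockDist (suc ℓ)) + slack
    ≡⟨ cong (_+ slack) (weightedSum-pcSizes κ ℓ a (suc b′) (blockDist (suc ℓ))) ⟩
  shape (sumBelow ℓ (blockDist ℓ)) (blockDist ℓ ℓ) (blockDist ℓ (suc ℓ))
    ≡⟨ cong₂ (λ s d → shape s d (blockDist ℓ (suc ℓ))) (sumBelow-blockDist ℓ) (blockDist-self ℓ) ⟩
  shape (choose2 (suc ℓ)) 1 (blockDist ℓ (suc ℓ))
    ≡⟨ cong (shape (choose2 (suc ℓ)) 1) (blockDist-suc ℓ) ⟩
  shape (choose2 (suc ℓ)) 1 1
    ≡⟨ lemma κ ℓ a b′ (choose2 (suc ℓ)) ⟩
  suc (maxTransmission κ ℓ a (suc b′))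
    ∎
  where
  open ≡-Reasoning
  slack = suc (a * ℓ + b′ * suc ℓ)
  shape : ℕ → ℕ → ℕ → ℕ
  shape s d e = suc ℓ + (κ * s + a * d + suc b′ * e) + slack
  lemma : ∀ κ ℓ a b′ c → suc ℓ + (κ * c + a * 1 + suc b′ * 1) + suc (a * ℓ + b′ * suc ℓ)
                        ≡ suc (κ * c + a * suc ℓ + suc b′ * suc (suc ℓ))
  lemma = solve-∀

weightedSum-last : ∀ κ ℓ α b′ →
  weightedSum (pcSizes κ ℓ (κ + α) (suc b′)) (blockDist (2 + ℓ)) + (α * ℓ + b′ * suc ℓ)
  ≡ suc (maxTransmission κ ℓ (κ + α) (suc b′))
weightedSum-last κ ℓ α b′ = begin
  weightedSum (pcSizes κ ℓ (κ + α) (suc b′)) (blockDist (2 + ℓ)) + slack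
    ≡⟨ cong (_+ slack) (weightedSum-pcSizes κ ℓ (κ + α) (suc b′) (blockDist (2 + ℓ))) ⟩
  shape (sumBelow ℓ (blockDist (suc ℓ))) (blockDist (suc ℓ) ℓ) (blockDist (suc ℓ) (suc ℓ))
    ≡⟨ cong₂ (λ s d → shape s d (blockDist (suc ℓ) (suc ℓ))) (sumBelow-blockDist-suc ℓ)
             (trans (blockDist-sym (suc ℓ) ℓ) (blockDist-suc ℓ)) ⟩
  shape (ℓ + choose2 (suc ℓ)) 1 (blockDist (suc ℓ) (suc ℓ))
    ≡⟨ cong (shape (ℓ + choose2 (suc ℓ)) 1) (blockDist-self (suc ℓ)) ⟩
  shape (ℓ + choose2 (suc ℓ)) 1 1
    ≡⟨ lemma κ ℓ α b′ (choose2 (suc ℓ)) ⟩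
  suc (maxTransmission κ ℓ (κ + α) (suc b′))
    ∎
  where
  open ≡-Reasoning
  slack = α * ℓ + b′ * suc ℓ
  shape : ℕ → ℕ → ℕ → ℕ
  shape s d e = 2 + ℓ + (κ * s + (κ + α) * d + suc b′ * e) + slack
  lemma : ∀ κ ℓ α b′ c → 2 + ℓ + (κ * (ℓ + c) + (κ + α) * 1 + suc b′ * 1) + (α * ℓ + b′ * suc ℓ)
                        ≡ suc (κ * c + (κ + α) * suc ℓ + suc b′ * suc (suc ℓ))
  lemma = solve-∀

data Block (ℓ : ℕ) : ℕ → Set where
  first       : Block ℓ 0
  inner       : ∀ j k → ℓ ≡ j + suc k → Block ℓ (suc j)
  penultimate : Block ℓ (suc ℓ)
  last        : Block ℓ (2 + ℓ)

block : ∀ ℓ {r} → r < 3 + ℓ → Block ℓ r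
block ℓ {zero}  _ = first
block ℓ {suc j} (s≤s j<2+ℓ) with <-cmp j ℓ
... | tri< j<ℓ _ _ with m≤n⇒∃[o]m+o≡n j<ℓ
...   | k , 1+j+k≡ℓ = inner j k (trans (sym 1+j+k≡ℓ) (sym (+-suc j k)))
block ℓ {suc j} _ | tri≈ _ refl _ = penultimate
block ℓ {suc j} (s≤s j<2+ℓ) | tri> _ _ ℓ<j = subst (Block ℓ ∘ suc) (≤-antisym ℓ<j (s≤s⁻¹ j<2+ℓ)) last

length-pcSizes : ∀ κ ℓ a b → length (pcSizes κ ℓ a b) ≡ 3 + ℓ
length-pcSizes κ ℓ a b =
  cong suc (trans (length-++ (replicate ℓ κ)) (trans (cong (_+ 2) (length-replicate ℓ)) (+-comm ℓ 2)))

module PathComplete (κ ℓ α b′ : ℕ) (1≤κ : 1 ≤ κ) where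

  a b : ℕ
  a = κ + α
  b = suc b′

  positive : All (1 ≤_) (pcSizes κ ℓ a b)
  positive = s≤s z≤n ∷ replicate⁺ ℓ (≤-trans 1≤κ (m≤m+n κ α) ∷ s≤s z≤n ∷ [])
    where
    replicate⁺ : ∀ m {xs} → All (1 ≤_) xs → All (1 ≤_) (replicate m κ ++ xs)
    replicate⁺ zero    ps = ps
    replicate⁺ (suc m) ps = 1≤κ ∷ replicate⁺ m ps

  open SequentialSum (pcSizes κ ℓ a b) positive public

  maxT : ℕ
  maxT = maxTransmission κ ℓ a b

  front : List ℕ
  front = 1 ∷ replicate ℓ κ ++ a ∷ []

  pcSizes≡front++ : pcSizes κ ℓ a b ≡ front ++ b ∷ []
  pcSizes≡front++ = cong (1 ∷_) (sym (++-assoc (replicate ℓ κ) (a ∷ []) (b ∷ [])))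

  length-front : length front ≡ 2 + ℓ
  length-front = cong suc (trans (length-++ (replicate ℓ κ)) (trans (cong (_+ 1) (length-replicate ℓ)) (+-comm ℓ 1)))

  B<3+ℓ : ∀ v → B v < 3 + ℓ
  B<3+ℓ v = subst (B v <_) (length-pcSizes κ ℓ a b) (B<length v)

  first-unique : ∀ {v} → B v ≡ 0 → v ≡ Fin.zero
  first-unique {v} Bv≡0 = toℕ-injective (index≡0 (toℕ v) Bv≡0)
    where
    index≡0 : ∀ t → blockOf (pcSizes κ ℓ a b) t ≡ 0 → t ≡ 0
    index≡0 zero    _ = refl
    index≡0 (suc t) ()

  last-unique : b′ ≡ 0 → ∀ {v w} → B v ≡ 2 + ℓ → B w ≡ 2 + ℓ → v ≡ w
  last-unique refl {v} {w} Bv≡ Bw≡ = toℕ-injective (trans (index≡ v Bv≡) (sym (index≡ w Bw≡)))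
    where
    n≡ : n ≡ sum front + 1
    n≡ = trans (cong sum pcSizes≡front++) (sum-++ front (1 ∷ []))
    index≡ : ∀ v → B v ≡ 2 + ℓ → toℕ v ≡ sum front
    index≡ v Bv≡ = ≤-antisym
      (s≤s⁻¹ (subst (toℕ v <_) (trans n≡ (+-comm (sum front) 1)) (toℕ<n v)))
      (blockOf-++-≥ front (b ∷ []) (subst₂ _≤_ (sym length-front)
        (trans (sym Bv≡) (cong (λ ss → blockOf ss (toℕ v)) pcSizes≡front++)) ≤-refl))

  σ+slack : ∀ v {r} s → B v ≡ r → weightedSum (pcSizes κ ℓ a b) (blockDist r) + s ≡ suc maxT → σ H v + s ≡ maxT
  σ+slack v s refl W+s≡ = suc-injective (trans (cong (_+ s) (trans (+-comm 1 (σ H v)) (σ-blocks v))) W+s≡)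

  σ-first : ∀ v → B v ≡ 0 → σ H v ≡ maxT
  σ-first v Bv≡0 = trans (sym (+-identityʳ (σ H v))) (σ+slack v 0 Bv≡0 (trans (+-identityʳ _) (weightedSum-first κ ℓ a b)))

  σ-last : ∀ v → B v ≡ 2 + ℓ → σ H v + (α * ℓ + b′ * suc ℓ) ≡ maxT
  σ-last v Bv≡ = σ+slack v _ Bv≡ (weightedSum-last κ ℓ α b′)

  σ-cases : ∀ v → B v ≡ 0 ⊎ σ H v < maxT ⊎ (b′ ≡ 0 × B v ≡ 2 + ℓ)
  σ-cases v = classify (block ℓ (B<3+ℓ v)) refl
    where
    below : ∀ s → σ H v + suc s ≡ maxT → σ H v < maxT
    below s σ+s≡ = ≤-trans (m<m+n (σ H v) (s≤s z≤n)) (≤-reflexive σ+s≡)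
    classify : ∀ {r} → Block ℓ r → B v ≡ r → B v ≡ 0 ⊎ σ H v < maxT ⊎ (b′ ≡ 0 × B v ≡ 2 + ℓ)
    classify first            Bv≡ = inj₁ Bv≡
    classify (inner j k refl) Bv≡ = inj₂ (inj₁ (below _ (σ+slack v _ Bv≡ (weightedSum-inner κ j k a b′))))
    classify penultimate      Bv≡ = inj₂ (inj₁ (below _ (σ+slack v _ Bv≡ (weightedSum-penultimate κ ℓ a b′))))
    classify last             Bv≡ with m≤n⇒m<n∨m≡n (z≤n {b′})
    ... | inj₂ 0≡b′ = inj₂ (inj₂ (sym 0≡b′ , Bv≡))
    ... | inj₁ 0<b′ = inj₂ (inj₁ (≤-trans (m<m+n (σ H v) 0<slack) (≤-reflexive (σ-last v Bv≡))))
      where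
      0<slack : 0 < α * ℓ + b′ * suc ℓ
      0<slack = ≤-trans (*-mono-≤ 0<b′ (s≤s z≤n)) (m≤n+m (b′ * suc ℓ) (α * ℓ))

  σ≤maxT : ∀ v → σ H v ≤ maxT
  σ≤maxT v with σ-cases v
  ... | inj₁ Bv≡0              = ≤-reflexive (σ-first v Bv≡0)
  ... | inj₂ (inj₁ σ<)         = <⇒≤ σ<
  ... | inj₂ (inj₂ (_ , Bv≡))  = ≤-trans (m≤m+n (σ H v) _) (≤-reflexive (σ-last v Bv≡))

  maxσ≡maxT : maxσ H ≡ maxT
  maxσ≡maxT = ≤-antisym (foldr-⊔-≤ (σ H) σ≤maxT (allFin n))
                        (subst (_≤ maxσ H) (σ-first Fin.zero refl) (≤-foldr-⊔ (σ H) (∈-allFin Fin.zero)))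

  2≤n : 2 ≤ n
  2≤n = ≤-trans (s≤s (s≤s z≤n)) (≤-trans (≤-reflexive (sym (length-pcSizes κ ℓ a b))) (length≤sum positive))

  module Shortcut (G′ : Graph n) (H⊆G′ : ∀ x y → T (H x y) → T (G′ x y))
                  (x y : Fin n) (gap : 2 + B x ≤ B y) (x~y : T (G′ x y)) (y~x : T (G′ y x)) where

    open Supergraph G′ H⊆G′

    σ′<maxT : ∀ z → σ G′ z < maxT
    σ′<maxT z with σ-cases z
    ... | inj₁ Bz≡0 = begin-strict
      σ G′ z <⟨ σ-⊇-< z y (shortcut z x y x~y same-block far) ⟩
      σ H z  ≡⟨ σ-first z Bz≡0 ⟩
      maxT   ∎
      where
      open ≤-Reasoning
      same-block : B z ≡ B x → z ≡ x
      same-block Bz≡Bx = trans (first-unique Bz≡0) (sym (first-unique (trans (sym Bz≡Bx) Bz≡0)))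
      far : suc ∣ B z - B x ∣ < ∣ B z - B y ∣
      far rewrite Bz≡0 = gap
    ... | inj₂ (inj₁ σ<maxT) = ≤-<-trans (σ-⊇ z) σ<maxT
    ... | inj₂ (inj₂ (b′≡0 , Bz≡)) = <-≤-trans (σ-⊇-< z x (shortcut z y x y~x same-block far)) (σ≤maxT z)
      where
      same-block : B z ≡ B y → z ≡ y
      same-block Bz≡By = last-unique b′≡0 Bz≡ (trans (sym Bz≡By) Bz≡)
      By≤ : B y ≤ 2 + ℓ
      By≤ = s≤s⁻¹ (B<3+ℓ y)
      far : suc ∣ B z - B y ∣ < ∣ B z - B x ∣
      far rewrite Bz≡ | m≤n⇒∣n-m∣≡n∸m By≤ | m≤n⇒∣n-m∣≡n∸m (≤-trans (≤-trans (n≤1+n _) (<⇒≤ gap)) By≤) =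
        ≤-trans (s≤s (∸-monoʳ-< gap By≤)) (∸-monoʳ-< (n<1+n (B x)) (≤-trans (<⇒≤ gap) By≤))

    maxσ′<maxσ : maxσ G′ < maxσ H
    maxσ′<maxσ = subst (maxσ G′ <_) (sym maxσ≡maxT)
                   (foldr-⊔-< (σ G′) (≤-<-trans z≤n (σ′<maxT Fin.zero)) σ′<maxT (allFin n))

/-monoˡ-< : ∀ k {x y} → x < y → ℤ.+ x ℚ./ suc k ℚ.< ℤ.+ y ℚ./ suc k
/-monoˡ-< k {x} {y} x<y = ℚ.toℚᵘ-cancel-<
  (ℚᵘ.<-respˡ-≃ (ℚᵘ.≃-sym (ℚ.toℚᵘ-fromℚᵘ (mkℚᵘ (ℤ.+ x) k)))
    (ℚᵘ.<-respʳ-≃ (ℚᵘ.≃-sym (ℚ.toℚᵘ-fromℚᵘ (mkℚᵘ (ℤ.+ y) k)))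
      (*<* (ℤ.*-monoʳ-<-pos (ℤ.+ suc k) (+<+ x<y)))))

ρ-< : ∀ {n₁ n₂} (G₁ : Graph n₁) (G₂ : Graph n₂) → n₁ ≡ n₂ → 2 ≤ n₁ →
      maxσ G₁ < maxσ G₂ → ρ G₁ ℚ.< ρ G₂
ρ-< {suc (suc k)} G₁ G₂ refl _ = /-monoˡ-< k

2≤∣-∣ : ∀ {p q} → 2 ≤ ∣ p - q ∣ → 2 + p ≤ q ⊎ 2 + q ≤ p
2≤∣-∣ {zero}        {suc (suc q)} _ = inj₁ (s≤s (s≤s z≤n))
2≤∣-∣ {suc (suc p)} {zero}        _ = inj₂ (s≤s (s≤s z≤n))
2≤∣-∣ {suc p}       {suc q}       gap with 2≤∣-∣ {p} {q} gap
... | inj₁ p+2≤q = inj₁ (s≤s p+2≤q)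
... | inj₂ q+2≤p = inj₂ (s≤s q+2≤p)
2≤∣-∣ {zero}       {zero}       ()
2≤∣-∣ {zero}       {suc zero}   (s≤s ())
2≤∣-∣ {suc zero}   {zero}       (s≤s ())

addEdge-joins : ∀ {n} (G : Graph n) u v → T (addEdge G u v u v)
addEdge-joins G u v with u ≟ u | v ≟ v
... | yes _   | yes _   = from (T-∨ {G u v}) (inj₂ _)
... | no u≢u  | _       = contradiction refl u≢u
... | yes _   | no v≢v  = contradiction refl v≢v

addEdge-joins′ : ∀ {n} (G : Graph n) u v → T (addEdge G u v v u)
addEdge-joins′ G u v with u ≟ u | v ≟ v
... | yes _   | yes _   = from (T-∨ {G v u}) (inj₂ (from (T-∨ {⌊ v ≟ u ⌋ ∧ ⌊ u ≟ v ⌋}) (inj₂ _)))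
... | no u≢u  | _       = contradiction refl u≢u
... | yes _   | no v≢v  = contradiction refl v≢v

-- Unlike part (a) of the theorem, this does not need ℓ ≥ 1.
ρ-addEdge-< : (κ : ℕ) → .{{_ : NonZero κ}} → (ℓ a b : ℕ) → κ ≤ a → 1 ≤ b →
              (u v : Fin (sum (pcSizes κ ℓ a b))) → u ≢ v → pathComplete κ ℓ a b u v ≡ false →
              ρ (addEdge (pathComplete κ ℓ a b) u v) ℚ.< ρ (pathComplete κ ℓ a b)
ρ-addEdge-< κ ℓ a (suc b′) κ≤a _ u v u≢v u≁v with m≤n⇒∃[o]m+o≡n κ≤a
... | α , refl = ρ-< G′ H refl 2≤n maxσ′<maxσ
  where
  open PathComplete κ ℓ α b′ (>-nonZero⁻¹ κ)
  G′ : Graph n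
  G′ = addEdge H u v
  H⊆G′ : ∀ x y → T (H x y) → T (G′ x y)
  H⊆G′ x y e = from (T-∨ {H x y}) (inj₁ e)
  u~v : T (G′ u v)
  u~v = addEdge-joins H u v
  v~u : T (G′ v u)
  v~u = addEdge-joins′ H u v
  far : 2 ≤ ∣ B u - B v ∣
  far = ≰⇒> (λ near → subst T u≁v (from adjacent⇔ (u≢v , near)))
  maxσ′<maxσ : maxσ G′ < maxσ H
  maxσ′<maxσ with 2≤∣-∣ far
  ... | inj₁ gap = Shortcut.maxσ′<maxσ G′ H⊆G′ u v gap u~v v~u
  ... | inj₂ gap = Shortcut.maxσ′<maxσ G′ H⊆G′ v u gap v~u u~v

indicator : Bool → ℕ
indicator b = if b then 1 else 0

<ᵇ≡true : ∀ {m n} → m < n → (m <ᵇ n) ≡ true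
<ᵇ≡true m<n = to T-≡ (<⇒<ᵇ m<n)

<ᵇ≡false : ∀ {m n} → ¬ m < n → (m <ᵇ n) ≡ false
<ᵇ≡false {m} {n} m≮n with m <ᵇ n in eq
... | true  = contradiction (<ᵇ⇒< m n (subst T (sym eq) _)) m≮n
... | false = refl

+-<ᵇ-+ : ∀ s t u → (s + t <ᵇ s + u) ≡ (t <ᵇ u)
+-<ᵇ-+ zero    t u = refl
+-<ᵇ-+ (suc s) t u = +-<ᵇ-+ s t u

adjacentBlocks : ℕ → ℕ → Bool
adjacentBlocks p q = (p ≤ᵇ suc q) ∧ (q ≤ᵇ suc p)

adjacentBlocks-suc : ∀ p q → adjacentBlocks (suc p) (suc q) ≡ adjacentBlocks p q
adjacentBlocks-suc p q = cong₂ _∧_ (suc-≤ᵇ-suc p (suc q)) (suc-≤ᵇ-suc q (suc p))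
  where
  suc-≤ᵇ-suc : ∀ m n → (suc m ≤ᵇ suc n) ≡ (m ≤ᵇ n)
  suc-≤ᵇ-suc zero    n = refl
  suc-≤ᵇ-suc (suc m) n = refl

orderedEdge : List ℕ → ℕ → ℕ → ℕ
orderedEdge ss t u = indicator ((t <ᵇ u) ∧ adjacentBlocks (blockOf ss t) (blockOf ss u))

edgeSum : List ℕ → ℕ
edgeSum ss = sumBelow (sum ss) (λ t → sumBelow (sum ss) (orderedEdge ss t))

headOr0 : List ℕ → ℕ
headOr0 []      = 0
headOr0 (s ∷ _) = s

edgeCount : List ℕ → ℕ
edgeCount []       = 0
edgeCount (s ∷ ss) = choose2 s + s * headOr0 ss + edgeCount ss

size-seqSumK≡edgeSum : ∀ ss → size (seqSumK ss) ≡ edgeSum ss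
size-seqSumK≡edgeSum ss = trans (sum-map-allFin n _) (trans (sum-cong-≗ row) (∑-toℕ n _))
  where
  n = sum ss
  entry : ∀ i j → (if (toℕ i <ᵇ toℕ j) ∧ seqSumK ss i j then 1 else 0) ≡ orderedEdge ss (toℕ i) (toℕ j)
  entry i j with toℕ i <ᵇ toℕ j in i<j
  ... | false = refl
  ... | true with i ≟ j
  ...   | yes refl = contradiction (<ᵇ⇒< (toℕ i) (toℕ i) (subst T (sym i<j) _)) (<-irrefl refl)
  ...   | no _     = refl
  row : ∀ i → sum (map (λ j → if (toℕ i <ᵇ toℕ j) ∧ seqSumK ss i j then 1 else 0) (allFin n))
            ≡ sumBelow n (orderedEdge ss (toℕ i))
  row i = trans (sum-map-allFin n _) (trans (sum-cong-≗ (entry i)) (∑-toℕ n _))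

sumBelow-pairs : ∀ s → sumBelow s (λ t → sumBelow s (λ u → indicator (t <ᵇ u))) ≡ choose2 s
sumBelow-pairs zero    = refl
sumBelow-pairs (suc s) = cong₂ _+_ (trans (sumBelow-const s 1) (*-identityʳ s)) (sumBelow-pairs s)

sumBelow-firstBlock : ∀ ss → sumBelow (sum ss) (λ u → indicator (blockOf ss u <ᵇ 1)) ≡ headOr0 ss
sumBelow-firstBlock []       = refl
sumBelow-firstBlock (s ∷ ss) = begin
  sumBelow (sum (s ∷ ss)) (λ u → indicator (blockOf (s ∷ ss) u <ᵇ 1))
    ≡⟨ sumBelow-blockOf (s ∷ ss) (λ q → indicator (q <ᵇ 1)) ⟩
  s * 1 + weightedSum ss (λ _ → 0)
    ≡⟨ cong₂ _+_ (*-identityʳ s) (weightedSum-zero ss) ⟩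
  s + 0
    ≡⟨ +-identityʳ s ⟩
  s
    ∎
  where
  open ≡-Reasoning
  weightedSum-zero : ∀ ss → weightedSum ss (λ _ → 0) ≡ 0
  weightedSum-zero []       = refl
  weightedSum-zero (s ∷ ss) = trans (cong (_+ weightedSum ss (λ _ → 0)) (*-zeroʳ s)) (weightedSum-zero ss)

edgeSum-∷ : ∀ s ss → edgeSum (s ∷ ss) ≡ choose2 s + s * headOr0 ss + edgeSum ss
edgeSum-∷ s ss = begin
  sumBelow (s + S) (λ t → sumBelow (s + S) (orderedEdge (s ∷ ss) t))
    ≡⟨ sumBelow-+ s S _ ⟩
  sumBelow s (λ t → sumBelow (s + S) (orderedEdge (s ∷ ss) t)) + sumBelow S (λ t → sumBelow (s + S) (orderedEdge (s ∷ ss) (s + t)))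
    ≡⟨ cong₂ _+_ (sumBelow-cong< s row-first) (sumBelow-cong S row-rest) ⟩
  sumBelow s (λ t → sumBelow s (λ u → indicator (t <ᵇ u)) + headOr0 ss) + edgeSum ss
    ≡⟨ cong (_+ edgeSum ss) (sumBelow-distrib-+ s _ _) ⟩
  sumBelow s (λ t → sumBelow s (λ u → indicator (t <ᵇ u))) + sumBelow s (λ _ → headOr0 ss) + edgeSum ss
    ≡⟨ cong₂ (λ x y → x + y + edgeSum ss) (sumBelow-pairs s) (sumBelow-const s (headOr0 ss)) ⟩
  choose2 s + s * headOr0 ss + edgeSum ss
    ∎
  where
  open ≡-Reasoning
  S = sum ss
  row-first : ∀ {t} → t < s → sumBelow (s + S) (orderedEdge (s ∷ ss) t) ≡ sumBelow s (λ u → indicator (t <ᵇ u)) + headOr0 ss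
  row-first {t} t<s = trans (sumBelow-+ s S _) (cong₂ _+_ (sumBelow-cong< s same) (trans (sumBelow-cong S next) (sumBelow-firstBlock ss)))
    where
    same : ∀ {u} → u < s → orderedEdge (s ∷ ss) t u ≡ indicator (t <ᵇ u)
    same u<s rewrite blockOf-< ss t<s | blockOf-< ss u<s = cong indicator (∧-identityʳ _)
    next : ∀ u → orderedEdge (s ∷ ss) t (s + u) ≡ indicator (blockOf ss u <ᵇ 1)
    next u rewrite blockOf-< ss t<s | blockOf-+ s ss u | <ᵇ≡true (≤-trans t<s (m≤m+n s u)) = refl
  row-rest : ∀ t → sumBelow (s + S) (orderedEdge (s ∷ ss) (s + t)) ≡ sumBelow S (orderedEdge ss t)
  row-rest t = trans (sumBelow-+ s S _)
    (cong₂ _+_ (trans (sumBelow-cong< s earlier) (trans (sumBelow-const s 0) (*-zeroʳ s))) (sumBelow-cong S later))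
    where
    earlier : ∀ {u} → u < s → orderedEdge (s ∷ ss) (s + t) u ≡ 0
    earlier u<s rewrite <ᵇ≡false (<⇒≱ (≤-trans u<s (m≤m+n s t)) ∘ <⇒≤) = refl
    later : ∀ u → orderedEdge (s ∷ ss) (s + t) (s + u) ≡ orderedEdge ss t u
    later u rewrite +-<ᵇ-+ s t u | blockOf-+ s ss t | blockOf-+ s ss u =
      cong (λ adj → indicator ((t <ᵇ u) ∧ adj)) (adjacentBlocks-suc (blockOf ss t) (blockOf ss u))

size-seqSumK : ∀ ss → size (seqSumK ss) ≡ edgeCount ss
size-seqSumK ss = trans (size-seqSumK≡edgeSum ss) (edgeSum≡edgeCount ss)
  where
  edgeSum≡edgeCount : ∀ ss → edgeSum ss ≡ edgeCount ss
  edgeSum≡edgeCount []       = refl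
  edgeSum≡edgeCount (s ∷ ss) = trans (edgeSum-∷ s ss) (cong (choose2 s + s * headOr0 ss +_) (edgeSum≡edgeCount ss))

size-pathComplete : ∀ κ ℓ′ a b → size (pathComplete κ (suc ℓ′) a b) ≡
  κ + (suc ℓ′ * choose2 κ + ℓ′ * (κ * κ) + κ * a + (choose2 a + a * b + choose2 b))
size-pathComplete κ ℓ′ a b = trans (size-seqSumK (pcSizes κ (suc ℓ′) a b)) (cong₂ _+_ (+-identityʳ κ) (cliques ℓ′))
  where
  cliques : ∀ ℓ′ → edgeCount (replicate (suc ℓ′) κ ++ a ∷ b ∷ []) ≡
            suc ℓ′ * choose2 κ + ℓ′ * (κ * κ) + κ * a + (choose2 a + a * b + choose2 b)
  cliques zero     = lemma κ a b (choose2 κ) (choose2 a) (choose2 b)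
    where
    lemma : ∀ κ a b cκ ca cb → cκ + κ * a + (ca + a * b + (cb + b * 0 + 0)) ≡ 1 * cκ + 0 * (κ * κ) + κ * a + (ca + a * b + cb)
    lemma = solve-∀
  cliques (suc ℓ′) = trans (cong (choose2 κ + κ * κ +_) (cliques ℓ′)) (lemma κ ℓ′ a b (choose2 κ) (choose2 a) (choose2 b))
    where
    lemma : ∀ κ ℓ′ a b cκ ca cb → cκ + κ * κ + (suc ℓ′ * cκ + ℓ′ * (κ * κ) + κ * a + (ca + a * b + cb))
                                  ≡ suc (suc ℓ′) * cκ + suc ℓ′ * (κ * κ) + κ * a + (ca + a * b + cb)
    lemma = solve-∀

sum-pcSizes : ∀ κ ℓ a b → sum (pcSizes κ ℓ a b) ≡ suc (ℓ * κ + a + b)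
sum-pcSizes κ ℓ a b = cong suc (trans (sum-++ (replicate ℓ κ) (a ∷ b ∷ []))
  (trans (cong₂ _+_ (sum-replicate ℓ) (cong (a +_) (+-identityʳ b))) (sym (+-assoc (ℓ * κ) a b))))
  where
  sum-replicate : ∀ ℓ → sum (replicate ℓ κ) ≡ ℓ * κ
  sum-replicate zero    = refl
  sum-replicate (suc ℓ) = cong (κ +_) (sum-replicate ℓ)

choose2-order : ∀ κ ℓ′ a b → choose2 (suc ℓ′ * κ + a + b) ≡
  suc ℓ′ * choose2 κ + κ * κ * (ℓ′ + choose2 ℓ′) + choose2 a + suc ℓ′ * κ * a + choose2 b + (suc ℓ′ * κ + a) * b
choose2-order κ ℓ′ a b = begin
  choose2 (suc ℓ′ * κ + a + b)
    ≡⟨ choose2-+ (suc ℓ′ * κ + a) b ⟩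
  choose2 (suc ℓ′ * κ + a) + choose2 b + (suc ℓ′ * κ + a) * b
    ≡⟨ cong (λ c → c + choose2 b + (suc ℓ′ * κ + a) * b) (choose2-+ (suc ℓ′ * κ) a) ⟩
  choose2 (suc ℓ′ * κ) + choose2 a + suc ℓ′ * κ * a + choose2 b + (suc ℓ′ * κ + a) * b
    ≡⟨ cong (λ c → c + choose2 a + suc ℓ′ * κ * a + choose2 b + (suc ℓ′ * κ + a) * b) (choose2-* (suc ℓ′) κ) ⟩
  suc ℓ′ * choose2 κ + κ * κ * (ℓ′ + choose2 ℓ′) + choose2 a + suc ℓ′ * κ * a + choose2 b + (suc ℓ′ * κ + a) * b
    ∎
  where open ≡-Reasoning

size+κ*maxTransmission : ∀ κ ℓ′ a b →
  size (pathComplete κ (suc ℓ′) a b) + κ * maxTransmission κ (suc ℓ′) a b + κ * κ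
  ≡ choose2 (suc ℓ′ * κ + a + b) + 2 * κ * (suc ℓ′ * κ + a + b) + κ
size+κ*maxTransmission κ ℓ′ a b = begin
  size (pathComplete κ (suc ℓ′) a b) + κ * maxTransmission κ (suc ℓ′) a b + κ * κ
    ≡⟨ cong (λ m → m + κ * maxTransmission κ (suc ℓ′) a b + κ * κ) (size-pathComplete κ ℓ′ a b) ⟩
  κ + (suc ℓ′ * cκ + ℓ′ * (κ * κ) + κ * a + (ca + a * b + cb))
    + κ * (κ * (suc ℓ′ + (ℓ′ + cℓ)) + a * suc (suc ℓ′) + b * suc (suc (suc ℓ′))) + κ * κ
    ≡⟨ lemma κ ℓ′ a b cκ ca cb cℓ ⟩
  suc ℓ′ * cκ + κ * κ * (ℓ′ + cℓ) + ca + suc ℓ′ * κ * a + cb + (suc ℓ′ * κ + a) * b + 2 * κ * (suc ℓ′ * κ + a + b) + κ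
    ≡⟨ cong (λ c → c + 2 * κ * (suc ℓ′ * κ + a + b) + κ) (choose2-order κ ℓ′ a b) ⟨
  choose2 (suc ℓ′ * κ + a + b) + 2 * κ * (suc ℓ′ * κ + a + b) + κ
    ∎
  where
  open ≡-Reasoning
  cκ = choose2 κ
  ca = choose2 a
  cb = choose2 b
  cℓ = choose2 ℓ′
  lemma : ∀ κ ℓ′ a b cκ ca cb cℓ →
    κ + (suc ℓ′ * cκ + ℓ′ * (κ * κ) + κ * a + (ca + a * b + cb))
      + κ * (κ * (suc ℓ′ + (ℓ′ + cℓ)) + a * suc (suc ℓ′) + b * suc (suc (suc ℓ′))) + κ * κ
    ≡ suc ℓ′ * cκ + κ * κ * (ℓ′ + cℓ) + ca + suc ℓ′ * κ * a + cb + (suc ℓ′ * κ + a) * b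
      + 2 * κ * (suc ℓ′ * κ + a + b) + κ
  lemma = solve-∀

maxTransmission-mono : ∀ κ ℓ j α b a₂ b₂ → 1 ≤ b₂ → ℓ * κ + (κ + α) + b ≡ (ℓ + suc j) * κ + a₂ + b₂ →
  maxTransmission κ ℓ (κ + α) b < maxTransmission κ (ℓ + suc j) a₂ b₂
maxTransmission-mono κ ℓ j α b a₂ b₂ 1≤b₂ same-order = begin-strict
  maxTransmission κ ℓ (κ + α) b             ≤⟨ m≤m+n _ α ⟩
  maxTransmission κ ℓ (κ + α) b + α         <⟨ m<m+n _ (≤-trans 1≤b₂ (m≤n+m b₂ _)) ⟩
  maxTransmission κ ℓ (κ + α) b + α + extra ≡⟨ gap ⟨
  maxTransmission κ (ℓ + suc j) a₂ b₂       ∎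
  where
  open ≤-Reasoning
  s₂ = a₂ + b₂
  extra = κ * choose2 j + j * s₂ + b₂
  α+b≡ : α + b ≡ j * κ + s₂
  α+b≡ = +-cancelˡ-≡ (ℓ * κ + κ) _ _ (trans (regroup₁ ℓ κ α b) (trans same-order (regroup₂ ℓ j κ a₂ b₂)))
    where
    regroup₁ : ∀ ℓ κ α b → ℓ * κ + κ + (α + b) ≡ ℓ * κ + (κ + α) + b
    regroup₁ = solve-∀
    regroup₂ : ∀ ℓ j κ a₂ b₂ → (ℓ + suc j) * κ + a₂ + b₂ ≡ ℓ * κ + κ + (j * κ + (a₂ + b₂))
    regroup₂ = solve-∀
  gap : maxTransmission κ (ℓ + suc j) a₂ b₂ ≡ maxTransmission κ ℓ (κ + α) b + α + extra
  gap = begin-equality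
    κ * choose2 (suc ℓ + suc j) + a₂ * suc (ℓ + suc j) + b₂ * suc (suc (ℓ + suc j))
      ≡⟨ cong (λ c → κ * c + a₂ * suc (ℓ + suc j) + b₂ * suc (suc (ℓ + suc j))) (choose2-+ (suc ℓ) (suc j)) ⟩
    κ * (choose2 (suc ℓ) + (j + choose2 j) + suc ℓ * suc j) + a₂ * suc (ℓ + suc j) + b₂ * suc (suc (ℓ + suc j))
      ≡⟨ expand₂ κ ℓ j a₂ b₂ (choose2 (suc ℓ)) (choose2 j) ⟩
    κ * choose2 (suc ℓ) + (κ + (j * κ + s₂)) * suc ℓ + (j * κ + s₂) + extra
      ≡⟨ cong (λ w → κ * choose2 (suc ℓ) + (κ + w) * suc ℓ + w + extra) α+b≡ ⟨
    κ * choose2 (suc ℓ) + (κ + (α + b)) * suc ℓ + (α + b) + extra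
      ≡⟨ cong (_+ extra) (expand₁ κ ℓ α b (choose2 (suc ℓ))) ⟨
    maxTransmission κ ℓ (κ + α) b + α + extra
      ∎
    where
    expand₁ : ∀ κ ℓ α b c → κ * c + (κ + α) * suc ℓ + b * suc (suc ℓ) + α ≡ κ * c + (κ + (α + b)) * suc ℓ + (α + b)
    expand₁ = solve-∀
    expand₂ : ∀ κ ℓ j a₂ b₂ cℓ cj →
      κ * (cℓ + (j + cj) + suc ℓ * suc j) + a₂ * suc (ℓ + suc j) + b₂ * suc (suc (ℓ + suc j))
      ≡ κ * cℓ + (κ + (j * κ + (a₂ + b₂))) * suc ℓ + (j * κ + (a₂ + b₂)) + (κ * cj + j * (a₂ + b₂) + b₂)
    expand₂ = solve-∀

maxTransmission-< : ∀ {κ ℓ a b ℓ₂ a₂ b₂} → κ ≤ a → 1 ≤ b₂ → ℓ < ℓ₂ → ℓ * κ + a + b ≡ ℓ₂ * κ + a₂ + b₂ →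
                    maxTransmission κ ℓ a b < maxTransmission κ ℓ₂ a₂ b₂
maxTransmission-< {κ} {ℓ} {a} {b} {ℓ₂} {a₂} {b₂} κ≤a 1≤b₂ ℓ<ℓ₂ same-order
  with m≤n⇒∃[o]m+o≡n κ≤a | m≤n⇒∃[o]m+o≡n ℓ<ℓ₂
... | α , refl | j , refl = subst (λ L → maxTransmission κ ℓ (κ + α) b < maxTransmission κ L a₂ b₂) (+-suc ℓ j)
  (maxTransmission-mono κ ℓ j α b a₂ b₂ 1≤b₂ (trans same-order (cong (λ L → L * κ + a₂ + b₂) (sym (+-suc ℓ j)))))

maxTransmission-injective : ∀ {κ ℓ a b ℓ₂ a₂ b₂} → κ ≤ a → 1 ≤ b → κ ≤ a₂ → 1 ≤ b₂ →
  ℓ * κ + a + b ≡ ℓ₂ * κ + a₂ + b₂ → maxTransmission κ ℓ a b ≡ maxTransmission κ ℓ₂ a₂ b₂ →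
  (ℓ , a , b) ≡ (ℓ₂ , a₂ , b₂)
maxTransmission-injective {κ} {ℓ} {a} {b} {ℓ₂} {a₂} {b₂} κ≤a 1≤b κ≤a₂ 1≤b₂ same-order same-maxT with <-cmp ℓ ℓ₂
... | tri< ℓ<ℓ₂ _ _ = contradiction same-maxT (<⇒≢ (maxTransmission-< κ≤a 1≤b₂ ℓ<ℓ₂ same-order))
... | tri> _ _ ℓ₂<ℓ = contradiction (sym same-maxT) (<⇒≢ (maxTransmission-< κ≤a₂ 1≤b ℓ₂<ℓ (sym same-order)))
... | tri≈ _ refl _ = cong₂ (λ a b → ℓ , a , b) a≡a₂ b≡b₂
  where
  split : ∀ a b → maxTransmission κ ℓ a b ≡ κ * choose2 (suc ℓ) + (a + b) * suc ℓ + b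
  split a b = lemma κ ℓ a b (choose2 (suc ℓ))
    where
    lemma : ∀ κ ℓ a b c → κ * c + a * suc ℓ + b * suc (suc ℓ) ≡ κ * c + (a + b) * suc ℓ + b
    lemma = solve-∀
  a+b≡ : a + b ≡ a₂ + b₂
  a+b≡ = +-cancelˡ-≡ (ℓ * κ) _ _ (trans (sym (+-assoc (ℓ * κ) a b)) (trans same-order (+-assoc (ℓ * κ) a₂ b₂)))
  b≡b₂ : b ≡ b₂
  b≡b₂ = +-cancelˡ-≡ (κ * choose2 (suc ℓ) + (a₂ + b₂) * suc ℓ) b b₂
    (trans (cong (λ s → κ * choose2 (suc ℓ) + s * suc ℓ + b) (sym a+b≡)) (trans (sym (split a b)) (trans same-maxT (split a₂ b₂))))
  a≡a₂ : a ≡ a₂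
  a≡a₂ = +-cancelʳ-≡ b a a₂ (trans a+b≡ (cong (a₂ +_) (sym b≡b₂)))

maxσ-pathComplete : ∀ κ ℓ a b → 1 ≤ κ → κ ≤ a → 1 ≤ b → maxσ (pathComplete κ ℓ a b) ≡ maxTransmission κ ℓ a b
maxσ-pathComplete κ ℓ a (suc b′) 1≤κ κ≤a _ with m≤n⇒∃[o]m+o≡n κ≤a
... | α , refl = PathComplete.maxσ≡maxT κ ℓ α b′ 1≤κ

size-ρ-antitone : (κ n : ℕ) → .{{_ : NonZero κ}} → (ℓ a b ℓ₂ a₂ b₂ : ℕ) →
  1 ≤ ℓ → κ ≤ a → 1 ≤ b → 1 ≤ ℓ₂ → κ ≤ a₂ → 1 ≤ b₂ →
  sum (pcSizes κ ℓ a b) ≡ n → sum (pcSizes κ ℓ₂ a₂ b₂) ≡ n → (ℓ , a , b) ≢ (ℓ₂ , a₂ , b₂) →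
  (size (pathComplete κ ℓ a b) < size (pathComplete κ ℓ₂ a₂ b₂)
    × ρ (pathComplete κ ℓ₂ a₂ b₂) ℚ.< ρ (pathComplete κ ℓ a b))
  ⊎ (size (pathComplete κ ℓ₂ a₂ b₂) < size (pathComplete κ ℓ a b)
    × ρ (pathComplete κ ℓ a b) ℚ.< ρ (pathComplete κ ℓ₂ a₂ b₂))
size-ρ-antitone κ n (suc l) a b (suc l₂) a₂ b₂ _ κ≤a 1≤b _ κ≤a₂ 1≤b₂ order₁ order₂ distinct =
  compare (<-cmp maxT₁ maxT₂)
  where
  H₁ = pathComplete κ (suc l) a b
  H₂ = pathComplete κ (suc l₂) a₂ b₂
  maxT₁ = maxTransmission κ (suc l) a b
  maxT₂ = maxTransmission κ (suc l₂) a₂ b₂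
  same-N : suc l * κ + a + b ≡ suc l₂ * κ + a₂ + b₂
  same-N = suc-injective (trans (sym (sum-pcSizes κ (suc l) a b)) (trans order₁ (trans (sym order₂) (sum-pcSizes κ (suc l₂) a₂ b₂))))
  conserved : size H₁ + κ * maxT₁ ≡ size H₂ + κ * maxT₂
  conserved = +-cancelʳ-≡ (κ * κ) _ _ (trans (size+κ*maxTransmission κ l a b)
    (trans (cong (λ N → choose2 N + 2 * κ * N + κ) same-N) (sym (size+κ*maxTransmission κ l₂ a₂ b₂))))
  flip : ∀ {x y u v} → x + κ * u ≡ y + κ * v → u < v → y < x
  flip x+κu≡y+κv u<v = ≰⇒> (λ x≤y → <-irrefl x+κu≡y+κv (+-mono-≤-< x≤y (*-monoʳ-< κ u<v)))
  2≤order : ∀ ℓ a b → 1 ≤ b → 2 ≤ sum (pcSizes κ ℓ a b)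
  2≤order ℓ a b 1≤b = subst (2 ≤_) (sym (sum-pcSizes κ ℓ a b)) (s≤s (≤-trans 1≤b (m≤n+m b _)))
  maxσ₁ = maxσ-pathComplete κ (suc l) a b (>-nonZero⁻¹ κ) κ≤a 1≤b
  maxσ₂ = maxσ-pathComplete κ (suc l₂) a₂ b₂ (>-nonZero⁻¹ κ) κ≤a₂ 1≤b₂
  compare : Tri (maxT₁ < maxT₂) (maxT₁ ≡ maxT₂) (maxT₂ < maxT₁) →
    (size H₁ < size H₂ × ρ H₂ ℚ.< ρ H₁) ⊎ (size H₂ < size H₁ × ρ H₁ ℚ.< ρ H₂)
  compare (tri< maxT₁<maxT₂ _ _) = inj₂ (flip conserved maxT₁<maxT₂ ,
    ρ-< H₁ H₂ (trans order₁ (sym order₂)) (2≤order (suc l) a b 1≤b)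
        (subst₂ _<_ (sym maxσ₁) (sym maxσ₂) maxT₁<maxT₂))
  compare (tri≈ _ same-maxT _) = contradiction (maxTransmission-injective κ≤a 1≤b κ≤a₂ 1≤b₂ same-N same-maxT) distinct
  compare (tri> _ _ maxT₂<maxT₁) = inj₁ (flip (sym conserved) maxT₂<maxT₁ ,
    ρ-< H₂ H₁ (trans order₂ (sym order₁)) (2≤order (suc l₂) a₂ b₂ 1≤b₂)
        (subst₂ _<_ (sym maxσ₂) (sym maxσ₁) maxT₂<maxT₁))

lowerBoundℤ : ℕ → ℕ → ℕ → ℤ
lowerBoundℤ n κ β = ℤ.+ n ℤ.* (ℤ.+ (3 * κ) ℤ.- ℤ.+ 1) ℤ.- ℤ.+ (2 * κ * κ) ℤ.- ℤ.+ κ ℤ.+ ℤ.+ 1 ℤ.- ℤ.+ (β * (κ ∸ β))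

positivePart : ℕ → ℕ → ℕ
positivePart n κ = n * (3 * κ ∸ 1) + 1

negativePart : ℕ → ℕ → ℕ
negativePart κ β = 2 * κ * κ + κ + β * (κ ∸ β)

lowerBoundℤ≡ : ∀ n κ β → 1 ≤ κ → lowerBoundℤ n κ β ≡ ℤ.+ positivePart n κ ℤ.- ℤ.+ negativePart κ β
lowerBoundℤ≡ n κ β 1≤κ = begin
  ℤ.+ n ℤ.* (ℤ.+ (3 * κ) ℤ.- ℤ.+ 1) ℤ.- ℤ.+ (2 * κ * κ) ℤ.- ℤ.+ κ ℤ.+ ℤ.+ 1 ℤ.- ℤ.+ (β * (κ ∸ β))
    ≡⟨ cong (λ z → z ℤ.- ℤ.+ (2 * κ * κ) ℤ.- ℤ.+ κ ℤ.+ ℤ.+ 1 ℤ.- ℤ.+ (β * (κ ∸ β))) n*[3κ-1] ⟩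
  ℤ.+ (n * (3 * κ ∸ 1)) ℤ.- ℤ.+ (2 * κ * κ) ℤ.- ℤ.+ κ ℤ.+ ℤ.+ 1 ℤ.- ℤ.+ (β * (κ ∸ β))
    ≡⟨ regroup (ℤ.+ (n * (3 * κ ∸ 1))) (ℤ.+ (2 * κ * κ)) (ℤ.+ κ) (ℤ.+ 1) (ℤ.+ (β * (κ ∸ β))) ⟩
  (ℤ.+ (n * (3 * κ ∸ 1)) ℤ.+ ℤ.+ 1) ℤ.- (ℤ.+ (2 * κ * κ) ℤ.+ ℤ.+ κ ℤ.+ ℤ.+ (β * (κ ∸ β)))
    ≡⟨ cong₂ ℤ._-_ (ℤ.pos-+ (n * (3 * κ ∸ 1)) 1)
                   (trans (ℤ.pos-+ (2 * κ * κ + κ) (β * (κ ∸ β))) (cong (ℤ._+ ℤ.+ (β * (κ ∸ β))) (ℤ.pos-+ (2 * κ * κ) κ))) ⟨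
  ℤ.+ positivePart n κ ℤ.- ℤ.+ negativePart κ β
    ∎
  where
  open ≡-Reasoning
  n*[3κ-1] : ℤ.+ n ℤ.* (ℤ.+ (3 * κ) ℤ.- ℤ.+ 1) ≡ ℤ.+ (n * (3 * κ ∸ 1))
  n*[3κ-1] = trans (cong (ℤ.+ n ℤ.*_) (trans (ℤ.m-n≡m⊖n (3 * κ) 1) (ℤ.⊖-≥ (≤-trans 1≤κ (m≤n*m κ 3)))))
                   (sym (ℤ.pos-* n (3 * κ ∸ 1)))
  regroup : ∀ p q r o t → p ℤ.- q ℤ.- r ℤ.+ o ℤ.- t ≡ (p ℤ.+ o) ℤ.- (q ℤ.+ r ℤ.+ t)
  regroup = ℤ-Solver.solve-∀

+-+≤+⇔ : ∀ x y z → (ℤ.+ x ℤ.- ℤ.+ y ℤ.≤ ℤ.+ z) ⇔ (x ≤ z + y)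
+-+≤+⇔ x y z = mk⇔ elim intro
  where
  cancel : ∀ (i j : ℤ) → i ℤ.- j ℤ.+ j ≡ i
  cancel = ℤ-Solver.solve-∀
  cancel′ : ∀ (i j : ℤ) → i ℤ.+ j ℤ.- j ≡ i
  cancel′ = ℤ-Solver.solve-∀
  elim : ℤ.+ x ℤ.- ℤ.+ y ℤ.≤ ℤ.+ z → x ≤ z + y
  elim x-y≤z = ℤ.drop‿+≤+ (subst₂ ℤ._≤_ (cancel (ℤ.+ x) (ℤ.+ y)) (sym (ℤ.pos-+ z y)) (ℤ.+-monoˡ-≤ (ℤ.+ y) x-y≤z))
  intro : x ≤ z + y → ℤ.+ x ℤ.- ℤ.+ y ℤ.≤ ℤ.+ z
  intro x≤z+y = subst (ℤ.+ x ℤ.- ℤ.+ y ℤ.≤_) (cancel′ (ℤ.+ z) (ℤ.+ y))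
    (ℤ.+-monoˡ-≤ (ℤ.- ℤ.+ y) (subst (ℤ.+ x ℤ.≤_) (ℤ.pos-+ z y) (+≤+ x≤z+y)))

lowerBound⇔ : ∀ n κ β m → 1 ≤ κ → (lowerBoundℤ n κ β ℤ.≤ ℤ.+ (2 * m)) ⇔ (positivePart n κ ≤ 2 * m + negativePart κ β)
lowerBound⇔ n κ β m 1≤κ rewrite lowerBoundℤ≡ n κ β 1≤κ = +-+≤+⇔ (positivePart n κ) (negativePart κ β) (2 * m)

residue-decomposition : ∀ N κ β .{{_ : NonZero κ}} → β ≤ κ → κ ≤ N → β % κ ≡ N % κ → ∃[ q ] N ≡ q * κ + β
residue-decomposition N κ β β≤κ κ≤N β≡N with β ℕ.≟ κ
... | no β≢κ = N / κ , trans (m≡m%n+[m/n]*n N κ)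
  (trans (cong (_+ (N / κ) * κ) (trans (sym β≡N) (m<n⇒m%n≡m (≤∧≢⇒< β≤κ β≢κ)))) (+-comm β _))
... | yes refl with N / κ in N/κ≡
...   | suc q = q , trans (m≡m%n+[m/n]*n N κ)
  (trans (cong₂ (λ r x → r + x * κ) (trans (sym β≡N) (n%n≡0 κ)) N/κ≡) (+-comm κ (q * κ)))
...   | zero  = contradiction (subst (κ ≤_) N≡0 κ≤N) (<⇒≱ (>-nonZero⁻¹ κ))
  where
  N≡0 : N ≡ 0
  N≡0 = trans (m≡m%n+[m/n]*n N κ) (trans (cong (λ x → N % κ + x * κ) N/κ≡) (trans (+-identityʳ _) (trans (sym β≡N) (n%n≡0 κ))))

quotient-≥ : ∀ q L κ β r → β ≤ κ → 1 ≤ r → q * κ + β ≡ L * κ + r → ∃[ c ] q ≡ L + c × c * κ + β ≡ r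
quotient-≥ q L κ β r β≤κ 1≤r same with L ≤? q
... | no L≰q = contradiction same (<⇒≢ (begin-strict
  q * κ + β   ≤⟨ +-monoʳ-≤ (q * κ) β≤κ ⟩
  q * κ + κ   ≡⟨ +-comm (q * κ) κ ⟩
  suc q * κ   ≤⟨ *-monoˡ-≤ κ (≰⇒> L≰q) ⟩
  L * κ       <⟨ m<m+n (L * κ) 1≤r ⟩
  L * κ + r   ∎))
  where open ≤-Reasoning
... | yes L≤q with m≤n⇒∃[o]m+o≡n L≤q
...   | c , refl = c , refl , +-cancelˡ-≡ (L * κ) _ _ (trans (regroup L c κ β) same)
  where
  regroup : ∀ L c κ β → L * κ + (c * κ + β) ≡ (L + c) * κ + β
  regroup = solve-∀

congruent⇒multiple : ∀ m M κ .{{_ : NonZero κ}} → m % κ ≡ M % κ → m ≤ M → ∃[ d ] M ≡ m + κ * d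
congruent⇒multiple m M κ m≡M m≤M with m≤n⇒∃[o]m+o≡n quotients≤
  where
  quotients≤ : m / κ ≤ M / κ
  quotients≤ = *-cancelʳ-≤ (m / κ) (M / κ) κ (+-cancelˡ-≤ (m % κ) _ _
    (subst₂ _≤_ (m≡m%n+[m/n]*n m κ) (trans (m≡m%n+[m/n]*n M κ) (cong (_+ (M / κ) * κ) (sym m≡M))) m≤M))
... | d , m/κ+d≡M/κ = d , (begin
  M                             ≡⟨ m≡m%n+[m/n]*n M κ ⟩
  M % κ + M / κ * κ             ≡⟨ cong₂ (λ r x → r + x * κ) (sym m≡M) (sym m/κ+d≡M/κ) ⟩
  m % κ + (m / κ + d) * κ       ≡⟨ regroup (m % κ) (m / κ) d κ ⟩
  m % κ + m / κ * κ + κ * d     ≡⟨ cong (_+ κ * d) (m≡m%n+[m/n]*n m κ) ⟨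
  m + κ * d                     ∎)
  where
  open ≡-Reasoning
  regroup : ∀ r x d κ → r + (x + d) * κ ≡ r + x * κ + κ * d
  regroup = solve-∀

deficit : ℕ → ℕ → ℕ → ℕ → ℕ
deficit κ ℓ′ α b′ = ℓ′ * (κ + α + suc b′) + κ * choose2 ℓ′ + b′

size+κ*deficit : ∀ κ ℓ′ α b′ →
  size (pathComplete κ (suc ℓ′) (κ + α) (suc b′)) + κ * deficit κ ℓ′ α b′ ≡ choose2 (suc ℓ′ * κ + (κ + α) + suc b′)
size+κ*deficit κ ℓ′ α b′ = begin
  size (pathComplete κ (suc ℓ′) a b) + κ * deficit κ ℓ′ α b′
    ≡⟨ cong (_+ κ * deficit κ ℓ′ α b′) (size-pathComplete κ ℓ′ a b) ⟩
  κ + (suc ℓ′ * cκ + ℓ′ * (κ * κ) + κ * a + (ca + a * b + cb)) + κ * (ℓ′ * (a + b) + κ * cℓ + b′)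
    ≡⟨ lemma κ ℓ′ α b′ cκ ca (choose2 b′) cℓ ⟩
  suc ℓ′ * cκ + κ * κ * (ℓ′ + cℓ) + ca + suc ℓ′ * κ * a + cb + (suc ℓ′ * κ + a) * b
    ≡⟨ choose2-order κ ℓ′ a b ⟨
  choose2 (suc ℓ′ * κ + a + b)
    ∎
  where
  open ≡-Reasoning
  a = κ + α
  b = suc b′
  cκ = choose2 κ
  ca = choose2 a
  cb = choose2 b
  cℓ = choose2 ℓ′
  lemma : ∀ κ ℓ′ α b′ cκ ca cb′ cℓ →
    κ + (suc ℓ′ * cκ + ℓ′ * (κ * κ) + κ * (κ + α) + (ca + (κ + α) * suc b′ + (b′ + cb′)))
      + κ * (ℓ′ * (κ + α + suc b′) + κ * cℓ + b′)
    ≡ suc ℓ′ * cκ + κ * κ * (ℓ′ + cℓ) + ca + suc ℓ′ * κ * (κ + α) + (b′ + cb′) + (suc ℓ′ * κ + (κ + α)) * suc b′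
  lemma = solve-∀

-- The least and the largest deficit of a graph with ℓ = ℓ′ + 1 and α + b′ = cκ + β₀, i.e. of
-- order (ℓ′ + c + 2)κ + β₀ + 2; the deficit grows with b′.
minDeficit : ℕ → ℕ → ℕ → ℕ → ℕ
minDeficit κ β ℓ′ c = ℓ′ * (suc c * κ + β) + κ * choose2 ℓ′

maxDeficit : ℕ → ℕ → ℕ → ℕ → ℕ
maxDeficit κ β₀ ℓ′ c = minDeficit κ (suc β₀) ℓ′ c + c * κ + β₀

deficit≤maxDeficit : ∀ κ β₀ ℓ′ c α b′ → α + b′ ≡ c * κ + β₀ → deficit κ ℓ′ α b′ ≤ maxDeficit κ β₀ (ℓ′ + c) 0
deficit≤maxDeficit κ β₀ ℓ′ c α b′ α+b′≡ = ≤-trans (m≤m+n _ (c * suc β₀ + κ * choose2 c + α)) (≤-reflexive (begin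
  deficit κ ℓ′ α b′ + (c * suc β₀ + κ * choose2 c + α)
    ≡⟨ regroup₁ κ ℓ′ α b′ (choose2 ℓ′) (c * suc β₀ + κ * choose2 c) ⟩
  ℓ′ * (κ + suc (α + b′)) + κ * choose2 ℓ′ + (c * suc β₀ + κ * choose2 c) + (α + b′)
    ≡⟨ cong (λ s → ℓ′ * (κ + suc s) + κ * choose2 ℓ′ + (c * suc β₀ + κ * choose2 c) + s) α+b′≡ ⟩
  ℓ′ * (κ + suc (c * κ + β₀)) + κ * choose2 ℓ′ + (c * suc β₀ + κ * choose2 c) + (c * κ + β₀)
    ≡⟨ regroup₂ κ β₀ ℓ′ c (choose2 ℓ′) (choose2 c) ⟩
  (ℓ′ + c) * (1 * κ + suc β₀) + κ * (choose2 ℓ′ + choose2 c + ℓ′ * c) + 0 * κ + β₀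
    ≡⟨ cong (λ z → (ℓ′ + c) * (1 * κ + suc β₀) + κ * z + 0 * κ + β₀) (choose2-+ ℓ′ c) ⟨
  maxDeficit κ β₀ (ℓ′ + c) 0
    ∎))
  where
  open ≡-Reasoning
  regroup₁ : ∀ κ ℓ′ α b′ cℓ x → ℓ′ * (κ + α + suc b′) + κ * cℓ + b′ + (x + α) ≡ ℓ′ * (κ + suc (α + b′)) + κ * cℓ + x + (α + b′)
  regroup₁ = solve-∀
  regroup₂ : ∀ κ β₀ ℓ′ c cℓ cc → ℓ′ * (κ + suc (c * κ + β₀)) + κ * cℓ + (c * suc β₀ + κ * cc) + (c * κ + β₀)
                                ≡ (ℓ′ + c) * (1 * κ + suc β₀) + κ * (cℓ + cc + ℓ′ * c) + 0 * κ + β₀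
  regroup₂ = solve-∀

maxDeficit-suc : ∀ κ β₀ ℓ′ c → suc (maxDeficit κ β₀ ℓ′ (suc c)) ≡ minDeficit κ (suc β₀) (suc ℓ′) c
maxDeficit-suc κ β₀ ℓ′ c = lemma κ β₀ ℓ′ c (choose2 ℓ′)
  where
  lemma : ∀ κ β₀ ℓ′ c cℓ → suc (ℓ′ * (suc (suc c) * κ + suc β₀) + κ * cℓ + suc c * κ + β₀) ≡ suc ℓ′ * (suc c * κ + suc β₀) + κ * (ℓ′ + cℓ)
  lemma = solve-∀

Configuration : ℕ → ℕ → ℕ → ℕ → Set
Configuration κ β₀ q D = Σ ℕ λ ℓ′ → Σ ℕ λ α → Σ ℕ λ b′ →
  suc ℓ′ * κ + (κ + α) + suc b′ ≡ q * κ + suc β₀ × deficit κ ℓ′ α b′ ≡ D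

deficit-surjective : ∀ κ β₀ ℓ′ c D → D ≤ maxDeficit κ β₀ ℓ′ c → Configuration κ β₀ (ℓ′ + c + 2) D
deficit-surjective κ β₀ zero c D D≤ with m≤n⇒∃[o]m+o≡n D≤
... | α , D+α≡ = 0 , α , D , order , deficit≡
  where
  order : 1 * κ + (κ + α) + suc D ≡ (c + 2) * κ + suc β₀
  order = begin
    1 * κ + (κ + α) + suc D ≡⟨ regroup₁ κ α D ⟩
    κ + κ + suc (D + α)    ≡⟨ cong (λ s → κ + κ + suc s) (trans D+α≡ (regroup₀ κ c β₀)) ⟩
    κ + κ + suc (c * κ + β₀) ≡⟨ regroup₂ κ c β₀ ⟩
    (c + 2) * κ + suc β₀   ∎
    where
    open ≡-Reasoning
    regroup₀ : ∀ κ c β₀ → 0 * (suc c * κ + suc β₀) + κ * 0 + c * κ + β₀ ≡ c * κ + β₀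
    regroup₀ = solve-∀
    regroup₁ : ∀ κ α D → 1 * κ + (κ + α) + suc D ≡ κ + κ + suc (D + α)
    regroup₁ = solve-∀
    regroup₂ : ∀ κ c β₀ → κ + κ + suc (c * κ + β₀) ≡ (c + 2) * κ + suc β₀
    regroup₂ = solve-∀
  deficit≡ : deficit κ 0 α D ≡ D
  deficit≡ = cong (_+ D) (*-zeroʳ κ)
deficit-surjective κ β₀ (suc ℓ′) c D D≤ with D ≤? maxDeficit κ β₀ ℓ′ (suc c)
... | yes D≤′ with deficit-surjective κ β₀ ℓ′ (suc c) D D≤′
...   | l , α , b′ , order , deficit≡ = l , α , b′ , trans order (cong (λ z → (z + 2) * κ + suc β₀) (+-suc ℓ′ c)) , deficit≡
deficit-surjective κ β₀ (suc ℓ′) c D D≤ | no D≰ with m≤n⇒∃[o]m+o≡n (≤-trans (≤-reflexive (sym (maxDeficit-suc κ β₀ ℓ′ c))) (≰⇒> D≰))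
... | b′ , lo+b′≡D with m≤n⇒∃[o]m+o≡n (+-cancelˡ-≤ (minDeficit κ (suc β₀) (suc ℓ′) c) b′ (c * κ + β₀)
                          (≤-trans (≤-reflexive lo+b′≡D) (≤-trans D≤ (≤-reflexive (+-assoc _ (c * κ) β₀)))))
...   | α , b′+α≡ = suc ℓ′ , α , b′ , order , deficit≡
  where
  open ≡-Reasoning
  order : suc (suc ℓ′) * κ + (κ + α) + suc b′ ≡ (suc ℓ′ + c + 2) * κ + suc β₀
  order = begin
    suc (suc ℓ′) * κ + (κ + α) + suc b′      ≡⟨ regroup₁ κ ℓ′ α b′ ⟩
    suc (suc ℓ′) * κ + κ + suc (b′ + α)      ≡⟨ cong (λ s → suc (suc ℓ′) * κ + κ + suc s) b′+α≡ ⟩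
    suc (suc ℓ′) * κ + κ + suc (c * κ + β₀)  ≡⟨ regroup₂ κ ℓ′ c β₀ ⟩
    (suc ℓ′ + c + 2) * κ + suc β₀            ∎
    where
    regroup₁ : ∀ κ ℓ′ α b′ → suc (suc ℓ′) * κ + (κ + α) + suc b′ ≡ suc (suc ℓ′) * κ + κ + suc (b′ + α)
    regroup₁ = solve-∀
    regroup₂ : ∀ κ ℓ′ c β₀ → suc (suc ℓ′) * κ + κ + suc (c * κ + β₀) ≡ (suc ℓ′ + c + 2) * κ + suc β₀
    regroup₂ = solve-∀
  deficit≡ : deficit κ (suc ℓ′) α b′ ≡ D
  deficit≡ = begin
    suc ℓ′ * (κ + α + suc b′) + κ * (ℓ′ + choose2 ℓ′) + b′         ≡⟨ regroup₁ κ ℓ′ α b′ (choose2 ℓ′) ⟩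
    suc ℓ′ * (κ + suc (b′ + α)) + κ * (ℓ′ + choose2 ℓ′) + b′       ≡⟨ cong (λ s → suc ℓ′ * (κ + suc s) + κ * (ℓ′ + choose2 ℓ′) + b′) b′+α≡ ⟩
    suc ℓ′ * (κ + suc (c * κ + β₀)) + κ * (ℓ′ + choose2 ℓ′) + b′   ≡⟨ regroup₂ κ ℓ′ c β₀ b′ (choose2 ℓ′) ⟩
    minDeficit κ (suc β₀) (suc ℓ′) c + b′                          ≡⟨ lo+b′≡D ⟩
    D                                                              ∎
    where
    regroup₁ : ∀ κ ℓ′ α b′ cℓ → suc ℓ′ * (κ + α + suc b′) + κ * (ℓ′ + cℓ) + b′ ≡ suc ℓ′ * (κ + suc (b′ + α)) + κ * (ℓ′ + cℓ) + b′
    regroup₁ = solve-∀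
    regroup₂ : ∀ κ ℓ′ c β₀ b′ cℓ → suc ℓ′ * (κ + suc (c * κ + β₀)) + κ * (ℓ′ + cℓ) + b′ ≡ suc ℓ′ * (suc c * κ + suc β₀) + κ * (ℓ′ + cℓ) + b′
    regroup₂ = solve-∀

negativePart-+ : ∀ β e → negativePart (β + e) β ≡ 2 * (β + e) * (β + e) + (β + e) + β * e
negativePart-+ β e = cong (λ z → 2 * (β + e) * (β + e) + (β + e) + β * z) (m+n∸m≡n β e)

positivePart-suc : ∀ n β₀ e → positivePart n (suc β₀ + e) ≡ n * (3 * (β₀ + e) + 2) + 1
positivePart-suc n β₀ e = cong (λ z → n * z + 1) (lemma (β₀ + e))
  where
  lemma : ∀ y → y + (suc y + (suc y + 0)) ≡ 3 * y + 2
  lemma = solve-∀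

2*choose2+negativePart : ∀ N β e →
  2 * choose2 N + negativePart (β + e) β + N ≡ N * N + (2 * (β + e) * (β + e) + (β + e) + β * e)
2*choose2+negativePart N β e = begin
  2 * choose2 N + negativePart (β + e) β + N ≡⟨ cong (λ z → 2 * choose2 N + z + N) (negativePart-+ β e) ⟩
  2 * choose2 N + K + N                      ≡⟨ regroup (choose2 N) N K ⟩
  choose2 N + choose2 N + N + K              ≡⟨ cong (_+ K) (choose2-double N) ⟩
  N * N + K                                  ∎
  where
  open ≡-Reasoning
  K = 2 * (β + e) * (β + e) + (β + e) + β * e
  regroup : ∀ c N K → 2 * c + K + N ≡ c + c + N + K
  regroup = solve-∀

-- The bound of (c) says 2m ≥ positivePart − negativePart, i.e. m ≥ C(n − 1, 2) − κ · maxDeficit.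
bound-identity : ∀ κ β₀ ℓ′ → suc β₀ ≤ κ → let N = (2 + ℓ′) * κ + suc β₀ in
  2 * choose2 N + negativePart κ (suc β₀) ≡ positivePart (suc N) κ + 2 * κ * maxDeficit κ β₀ ℓ′ 0
bound-identity _ β₀ ℓ′ β≤κ with m≤n⇒∃[o]m+o≡n β≤κ
... | e , refl = +-cancelʳ-≡ (N + κ * κ * ℓ′) _ _ (begin
  2 * choose2 N + negativePart κ β + (N + κ * κ * ℓ′)
    ≡⟨ regroup₁ (2 * choose2 N) (negativePart κ β) N (κ * κ * ℓ′) ⟩
  2 * choose2 N + negativePart κ β + N + κ * κ * ℓ′
    ≡⟨ cong (_+ κ * κ * ℓ′) (2*choose2+negativePart N β e) ⟩
  N * N + (2 * κ * κ + κ + β * e) + κ * κ * ℓ′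
    ≡⟨ polynomial ℓ′ β₀ e ⟩
  P + N + 2 * κ * (ℓ′ * (1 * κ + β) + 0 * κ + β₀) + κ * κ * (ℓ′ * ℓ′)
    ≡⟨ cong (λ z → P + N + 2 * κ * (ℓ′ * (1 * κ + β) + 0 * κ + β₀) + κ * κ * z) (choose2-double ℓ′) ⟨
  P + N + 2 * κ * (ℓ′ * (1 * κ + β) + 0 * κ + β₀) + κ * κ * (choose2 ℓ′ + choose2 ℓ′ + ℓ′)
    ≡⟨ regroup₂ P N κ ℓ′ β β₀ (choose2 ℓ′) ⟩
  P + 2 * κ * maxDeficit κ β₀ ℓ′ 0 + (N + κ * κ * ℓ′)
    ≡⟨ cong (λ z → z + 2 * κ * maxDeficit κ β₀ ℓ′ 0 + (N + κ * κ * ℓ′)) (positivePart-suc (suc N) β₀ e) ⟨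
  positivePart (suc N) κ + 2 * κ * maxDeficit κ β₀ ℓ′ 0 + (N + κ * κ * ℓ′)
    ∎)
  where
  open ≡-Reasoning
  κ = suc β₀ + e
  β = suc β₀
  N = (2 + ℓ′) * κ + β
  P = suc N * (3 * (β₀ + e) + 2) + 1
  regroup₁ : ∀ x y N z → x + y + (N + z) ≡ x + y + N + z
  regroup₁ = solve-∀
  regroup₂ : ∀ P N κ ℓ′ β β₀ c → P + N + 2 * κ * (ℓ′ * (1 * κ + β) + 0 * κ + β₀) + κ * κ * (c + c + ℓ′)
                               ≡ P + 2 * κ * (ℓ′ * (1 * κ + β) + κ * c + 0 * κ + β₀) + (N + κ * κ * ℓ′)
  regroup₂ = solve-∀
  polynomial : ∀ ℓ′ β₀ e → let κ = suc β₀ + e; N = (2 + ℓ′) * κ + suc β₀ in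
    N * N + (2 * κ * κ + κ + suc β₀ * e) + κ * κ * ℓ′
    ≡ suc N * (3 * (β₀ + e) + 2) + 1 + N + 2 * κ * (ℓ′ * (1 * κ + suc β₀) + 0 * κ + β₀) + κ * κ * (ℓ′ * ℓ′)
  polynomial = solve-∀

-- For q ≤ 1 there is no graph of order qκ + β + 1, and the bound exceeds C(n − 1, 2).
bound-unattainable₁ : ∀ κ β₀ → suc β₀ ≤ κ → let N = 1 * κ + suc β₀ in
  2 * choose2 N + negativePart κ (suc β₀) < positivePart (suc N) κ
bound-unattainable₁ _ β₀ β≤κ with m≤n⇒∃[o]m+o≡n β≤κ
... | e , refl = ≤-trans (m<m+n _ {2 * suc β₀ + 2 * e} (s≤s z≤n)) (≤-reflexive (+-cancelʳ-≡ N _ _ (begin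
  2 * choose2 N + negativePart κ (suc β₀) + (2 * suc β₀ + 2 * e) + N
    ≡⟨ regroup (2 * choose2 N + negativePart κ (suc β₀)) (2 * suc β₀ + 2 * e) N ⟩
  2 * choose2 N + negativePart κ (suc β₀) + N + (2 * suc β₀ + 2 * e)
    ≡⟨ cong (_+ (2 * suc β₀ + 2 * e)) (2*choose2+negativePart N (suc β₀) e) ⟩
  N * N + (2 * κ * κ + κ + suc β₀ * e) + (2 * suc β₀ + 2 * e)
    ≡⟨ polynomial β₀ e ⟩
  suc N * (3 * (β₀ + e) + 2) + 1 + N
    ≡⟨ cong (_+ N) (positivePart-suc (suc N) β₀ e) ⟨
  positivePart (suc N) κ + N
    ∎)))
  where
  open ≡-Reasoning
  κ = suc β₀ + e
  N = 1 * κ + suc β₀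
  regroup : ∀ x y N → x + y + N ≡ x + N + y
  regroup = solve-∀
  polynomial : ∀ β₀ e → let κ = suc β₀ + e; N = 1 * κ + suc β₀ in
    N * N + (2 * κ * κ + κ + suc β₀ * e) + (2 * suc β₀ + 2 * e) ≡ suc N * (3 * (β₀ + e) + 2) + 1 + N
  polynomial = solve-∀

bound-unattainable₀ : ∀ β₀ → let κ = suc β₀ + 0; N = 0 * κ + suc β₀ in
  2 * choose2 N + negativePart κ (suc β₀) < positivePart (suc N) κ
bound-unattainable₀ β₀ = ≤-trans (m<m+n _ {2 * suc β₀} (s≤s z≤n)) (≤-reflexive (+-cancelʳ-≡ N _ _ (begin
  2 * choose2 N + negativePart κ (suc β₀) + 2 * suc β₀ + N
    ≡⟨ regroup (2 * choose2 N + negativePart κ (suc β₀)) (2 * suc β₀) N ⟩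
  2 * choose2 N + negativePart κ (suc β₀) + N + 2 * suc β₀
    ≡⟨ cong (_+ 2 * suc β₀) (2*choose2+negativePart N (suc β₀) 0) ⟩
  N * N + (2 * κ * κ + κ + suc β₀ * 0) + 2 * suc β₀
    ≡⟨ polynomial β₀ ⟩
  suc N * (3 * (β₀ + 0) + 2) + 1 + N
    ≡⟨ cong (_+ N) (positivePart-suc (suc N) β₀ 0) ⟨
  positivePart (suc N) κ + N
    ∎)))
  where
  open ≡-Reasoning
  κ = suc β₀ + 0
  N = 0 * κ + suc β₀
  regroup : ∀ x y N → x + y + N ≡ x + N + y
  regroup = solve-∀
  polynomial : ∀ β₀ → let κ = suc β₀ + 0; N = 0 * κ + suc β₀ in
    N * N + (2 * κ * κ + κ + suc β₀ * 0) + 2 * suc β₀ ≡ suc N * (3 * (β₀ + 0) + 2) + 1 + N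
  polynomial = solve-∀

Realised : ℕ → ℕ → ℕ → Set
Realised κ n m = Σ ℕ λ ℓ → Σ ℕ λ a → Σ ℕ λ b →
  1 ≤ ℓ × κ ≤ a × 1 ≤ b × sum (pcSizes κ ℓ a b) ≡ n × size (pathComplete κ ℓ a b) ≡ m

realised⇒deficit : ∀ κ N m → Realised κ (suc N) m →
  ∃[ ℓ′ ] ∃[ α ] ∃[ b′ ] N ≡ suc ℓ′ * κ + (κ + α) + suc b′ × choose2 N ≡ m + κ * deficit κ ℓ′ α b′
realised⇒deficit κ N m (suc ℓ′ , a , suc b′ , _ , κ≤a , _ , order , size≡) with m≤n⇒∃[o]m+o≡n κ≤a
... | α , refl = ℓ′ , α , b′ , N≡ ,
  trans (cong choose2 N≡) (trans (sym (size+κ*deficit κ ℓ′ α b′)) (cong (_+ κ * deficit κ ℓ′ α b′) size≡))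
  where
  N≡ : N ≡ suc ℓ′ * κ + (κ + α) + suc b′
  N≡ = suc-injective (trans (sym order) (sum-pcSizes κ (suc ℓ′) (κ + α) (suc b′)))

realised⇒congruent : ∀ κ N m .{{_ : NonZero κ}} → Realised κ (suc N) m → m % κ ≡ choose2 N % κ × m ≤ choose2 N
realised⇒congruent κ N m realised with realised⇒deficit κ N m realised
... | ℓ′ , α , b′ , _ , C≡ = sym (trans (cong (_% κ) (trans C≡ (cong (λ x → m + x) (*-comm κ Y)))) ([m+kn]%n≡m%n m Y κ))
                              , ≤-trans (m≤m+n m (κ * Y)) (≤-reflexive (sym C≡))
  where
  Y = deficit κ ℓ′ α b′

realised⇒bound : ∀ N κ β₀ m q → suc β₀ ≤ κ → N ≡ q * κ + suc β₀ → Realised κ (suc N) m →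
  positivePart (suc N) κ ≤ 2 * m + negativePart κ (suc β₀)
realised⇒bound N κ β₀ m q β≤κ N≡qκ+β realised with realised⇒deficit κ N m realised
... | ℓ′ , α , b′ , N≡ , C≡ with quotient-≥ q (2 + ℓ′) κ (suc β₀) (α + suc b′) β≤κ (≤-trans (s≤s z≤n) (m≤n+m (suc b′) α))
                                   (trans (sym N≡qκ+β) (trans N≡ (regroup κ ℓ′ α b′)))
  where
  regroup : ∀ κ ℓ′ α b′ → suc ℓ′ * κ + (κ + α) + suc b′ ≡ (2 + ℓ′) * κ + (α + suc b′)
  regroup = solve-∀
... | c , refl , cκ+β≡ = +-cancelʳ-≤ (2 * κ * Y) _ _ (begin
  positivePart (suc N) κ + 2 * κ * Y                          ≤⟨ +-monoʳ-≤ (positivePart (suc N) κ) (*-monoʳ-≤ (2 * κ) Y≤) ⟩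
  positivePart (suc N) κ + 2 * κ * maxDeficit κ β₀ (ℓ′ + c) 0 ≡⟨ identity ⟨
  2 * choose2 N + negativePart κ (suc β₀)                     ≡⟨ cong (λ z → 2 * z + negativePart κ (suc β₀)) C≡ ⟩
  2 * (m + κ * Y) + negativePart κ (suc β₀)                   ≡⟨ regroup m κ Y (negativePart κ (suc β₀)) ⟩
  2 * m + negativePart κ (suc β₀) + 2 * κ * Y                 ∎)
  where
  open ≤-Reasoning
  Y = deficit κ ℓ′ α b′
  Y≤ : Y ≤ maxDeficit κ β₀ (ℓ′ + c) 0
  Y≤ = deficit≤maxDeficit κ β₀ ℓ′ c α b′ (suc-injective (trans (sym (+-suc α b′)) (trans (sym cκ+β≡) (+-suc (c * κ) β₀))))
  identity : 2 * choose2 N + negativePart κ (suc β₀) ≡ positivePart (suc N) κ + 2 * κ * maxDeficit κ β₀ (ℓ′ + c) 0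
  identity = subst (λ M → 2 * choose2 M + negativePart κ (suc β₀) ≡ positivePart (suc M) κ + 2 * κ * maxDeficit κ β₀ (ℓ′ + c) 0)
                   (sym (trans N≡qκ+β (cong (λ z → z * κ + suc β₀) (+-assoc 2 ℓ′ c))))
                   (bound-identity κ β₀ (ℓ′ + c) β≤κ)
  regroup : ∀ m κ Y K → 2 * (m + κ * Y) + K ≡ 2 * m + K + 2 * κ * Y
  regroup = solve-∀

2*size≤2*choose2 : ∀ N m κ D K → choose2 N ≡ m + κ * D → 2 * m + K ≤ 2 * choose2 N + K
2*size≤2*choose2 N m κ D K C≡ = +-monoˡ-≤ K (*-monoʳ-≤ 2 (≤-trans (m≤m+n m (κ * D)) (≤-reflexive (sym C≡))))

bound⇒deficit≤ : ∀ N κ β₀ ℓ′ m D → suc β₀ ≤ κ → N ≡ suc (suc ℓ′) * κ + suc β₀ → choose2 N ≡ m + κ * D →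
  positivePart (suc N) κ ≤ 2 * m + negativePart κ (suc β₀) → D ≤ maxDeficit κ β₀ ℓ′ 0
bound⇒deficit≤ N κ β₀ ℓ′ m D β≤κ N≡ C≡ bound =
  *-cancelˡ-≤ (2 * κ) {{>-nonZero (≤-trans (s≤s z≤n) (≤-trans β≤κ (m≤n*m κ 2)))}} (+-cancelˡ-≤ (2 * m + K) _ _ (begin
    2 * m + K + 2 * κ * D                           ≡⟨ regroup m κ D K ⟨
    2 * (m + κ * D) + K                             ≡⟨ cong (λ z → 2 * z + K) C≡ ⟨
    2 * choose2 N + K                               ≡⟨ identity ⟩
    positivePart (suc N) κ + 2 * κ * maxDeficit κ β₀ ℓ′ 0 ≤⟨ +-monoˡ-≤ (2 * κ * maxDeficit κ β₀ ℓ′ 0) bound ⟩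
    2 * m + K + 2 * κ * maxDeficit κ β₀ ℓ′ 0        ∎))
  where
  open ≤-Reasoning
  K = negativePart κ (suc β₀)
  identity : 2 * choose2 N + K ≡ positivePart (suc N) κ + 2 * κ * maxDeficit κ β₀ ℓ′ 0
  identity = subst (λ M → 2 * choose2 M + K ≡ positivePart (suc M) κ + 2 * κ * maxDeficit κ β₀ ℓ′ 0)
                   (sym N≡) (bound-identity κ β₀ ℓ′ β≤κ)
  regroup : ∀ m κ D K → 2 * (m + κ * D) + K ≡ 2 * m + K + 2 * κ * D
  regroup = solve-∀

configuration⇒realised : ∀ N κ β₀ ℓ′ m D → N ≡ suc (suc ℓ′) * κ + suc β₀ → choose2 N ≡ m + κ * D →
  Configuration κ β₀ (ℓ′ + 0 + 2) D → Realised κ (suc N) m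
configuration⇒realised N κ β₀ ℓ′ m D N≡ C≡ (l , α , b′ , order , deficit≡) =
  suc l , κ + α , suc b′ , s≤s z≤n , m≤m+n κ α , s≤s z≤n , trans (sum-pcSizes κ (suc l) (κ + α) (suc b′)) (cong suc order′) , size≡
  where
  H = pathComplete κ (suc l) (κ + α) (suc b′)
  order′ : suc l * κ + (κ + α) + suc b′ ≡ N
  order′ = trans order (trans (cong (λ z → z * κ + suc β₀) (trans (+-comm (ℓ′ + 0) 2) (cong (λ x → 2 + x) (+-identityʳ ℓ′))))
                              (sym N≡))
  size≡ : size H ≡ m
  size≡ = +-cancelʳ-≡ (κ * D) _ _ (begin
    size H + κ * D                          ≡⟨ cong (λ z → size H + κ * z) deficit≡ ⟨
    size H + κ * deficit κ l α b′           ≡⟨ size+κ*deficit κ l α b′ ⟩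
    choose2 (suc l * κ + (κ + α) + suc b′)  ≡⟨ cong choose2 order′ ⟩
    choose2 N                               ≡⟨ C≡ ⟩
    m + κ * D                               ∎)
    where open ≡-Reasoning

bound⇒realised : ∀ N κ β₀ m q D → suc β₀ ≤ κ → N ≡ q * κ + suc β₀ → κ ≤ N → choose2 N ≡ m + κ * D →
  positivePart (suc N) κ ≤ 2 * m + negativePart κ (suc β₀) → Realised κ (suc N) m
bound⇒realised N κ β₀ m zero D β≤κ N≡ κ≤N C≡ bound = contradiction bound (<⇒≱ (≤-<-trans (2*size≤2*choose2 N m κ D _ C≡)
  (subst₂ (λ κ M → 2 * choose2 M + negativePart κ (suc β₀) < positivePart (suc M) κ) (sym κ≡) (sym N≡′) (bound-unattainable₀ β₀))))
  where
  N≡′ : N ≡ 0 * (suc β₀ + 0) + suc β₀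
  N≡′ = N≡
  κ≡ : κ ≡ suc β₀ + 0
  κ≡ = trans (≤-antisym (subst (κ ≤_) N≡ κ≤N) β≤κ) (sym (+-identityʳ (suc β₀)))
bound⇒realised N κ β₀ m (suc zero) D β≤κ N≡ _ C≡ bound = contradiction bound (<⇒≱ (≤-<-trans (2*size≤2*choose2 N m κ D _ C≡)
  (subst (λ M → 2 * choose2 M + negativePart κ (suc β₀) < positivePart (suc M) κ) (sym N≡) (bound-unattainable₁ κ β₀ β≤κ))))
bound⇒realised N κ β₀ m (suc (suc ℓ′)) D β≤κ N≡ _ C≡ bound =
  configuration⇒realised N κ β₀ ℓ′ m D N≡ C≡ (deficit-surjective κ β₀ ℓ′ 0 D (bound⇒deficit≤ N κ β₀ ℓ′ m D β≤κ N≡ C≡ bound))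

size-characterisation : (n κ m : ℕ) → .{{_ : NonZero κ}} → κ < n →
  (b : ℕ) → 1 ≤ b → b ≤ κ → b % κ ≡ (n ∸ 1) % κ →
  Realised κ n m ⇔ ((m % κ ≡ ((n ∸ 1) C 2) % κ) × (lowerBoundℤ n κ b ℤ.≤ ℤ.+ (2 * m)) × m ≤ (n ∸ 1) C 2)
size-characterisation (suc N) κ m κ<n (suc β₀) _ β≤κ residue = mk⇔ necessary sufficient
  where
  κ≤N = s≤s⁻¹ κ<n
  bound⇔ = lowerBound⇔ (suc N) κ (suc β₀) m (>-nonZero⁻¹ κ)
  decomposition = residue-decomposition N κ (suc β₀) β≤κ κ≤N residue
  necessary : Realised κ (suc N) m → _
  necessary realised with realised⇒congruent κ N m realised | decomposition
  ... | m≡C , m≤C | q , N≡ = subst (λ c → m % κ ≡ c % κ) (sym (C2≡choose2 N)) m≡C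
                           , from bound⇔ (realised⇒bound N κ β₀ m q β≤κ N≡ realised)
                           , subst (m ≤_) (sym (C2≡choose2 N)) m≤C
  sufficient : _ → Realised κ (suc N) m
  sufficient (m≡C , bound , m≤C)
    with congruent⇒multiple m (choose2 N) κ (trans m≡C (cong (_% κ) (C2≡choose2 N))) (subst (m ≤_) (C2≡choose2 N) m≤C) | decomposition
  ... | D , C≡ | q , N≡ = bound⇒realised N κ β₀ m q D β≤κ N≡ κ≤N C≡ (to bound⇔ bound)

open import Data.Integer as Z using (+_)
open import Data.Rational as Q using ()

mainTheorem1 :
    -- (a)
    ((κ : ℕ) → .{{_ : NonZero κ}} → (ℓ a b : ℕ) → 1 ≤ ℓ → κ ≤ a → 1 ≤ b →
      (u v : Fin (sum (pcSizes κ ℓ a b))) → u ≢ v →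
      pathComplete κ ℓ a b u v ≡ false →
      ρ (addEdge (pathComplete κ ℓ a b) u v) Q.< ρ (pathComplete κ ℓ a b))
    ×
    -- (b)
    ((κ n : ℕ) → .{{_ : NonZero κ}} → (ℓ a b ℓ′ a′ b′ : ℕ) →
      1 ≤ ℓ → κ ≤ a → 1 ≤ b → 1 ≤ ℓ′ → κ ≤ a′ → 1 ≤ b′ →
      sum (pcSizes κ ℓ a b) ≡ n → sum (pcSizes κ ℓ′ a′ b′) ≡ n →
      (ℓ , a , b) ≢ (ℓ′ , a′ , b′) →
      (size (pathComplete κ ℓ a b) < size (pathComplete κ ℓ′ a′ b′)
        × ρ (pathComplete κ ℓ′ a′ b′) Q.< ρ (pathComplete κ ℓ a b))
      ⊎ (size (pathComplete κ ℓ′ a′ b′) < size (pathComplete κ ℓ a b)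
        × ρ (pathComplete κ ℓ a b) Q.< ρ (pathComplete κ ℓ′ a′ b′)))
    ×
    -- (c)
    ((n κ m : ℕ) → .{{_ : NonZero κ}} → κ < n →
      (b : ℕ) → 1 ≤ b → b ≤ κ → b % κ ≡ (n ∸ 1) % κ →
      (Σ ℕ λ ℓ → Σ ℕ λ a → Σ ℕ λ b′ →
          1 ≤ ℓ × κ ≤ a × 1 ≤ b′ ×
          sum (pcSizes κ ℓ a b′) ≡ n × size (pathComplete κ ℓ a b′) ≡ m)
      ⇔ ((m % κ ≡ ((n ∸ 1) C 2) % κ)
          × (+ n Z.* (+ (3 * κ) Z.- + 1) Z.- + (2 * κ * κ) Z.- + κ Z.+ + 1 Z.- + (b * (κ ∸ b)) Z.≤ + (2 * m))
          × m ≤ (n ∸ 1) C 2))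
mainTheorem1 = (λ κ ℓ a b _ → ρ-addEdge-< κ ℓ a b) , size-ρ-antitone , size-characterisation
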